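{- Consider a $2k$-tree $G$ for some $k\geq 2$. Suppose that $G$ has a good drawing $\phi$, and $v$ is a fan vertex in $\phi$. Let $G'$ be the $2k$-tree obtained from $G$ by adding a new vertex $w$ onto $N_G(v)$ (i.e. $w$ is made adjacent to exactly the vertices of $N_G(v)$). Then $w$ can be inserted into $\phi$ to obtain a good drawing $\phi'$ of $G'$.
   Context: A $k$-tree is either $K_{k+1}$ or a graph with a $k$-simplicial vertex $v$ (one whose neighbourhood is a $k$-clique) such that $G\setminus v$ is a $k$-tree. Fix $k\geq 2$ and let $I:=\{i,-i:1\leq i\leq k\}$. A geometric drawing maps vertices injectively to points of the plane and draws each edge as the straight segment between its endpoints; it is in general position if no three vertices are collinear. A drawing has thickness $k$ if its edges can be coloured $1,\dots,k$ so that edges of the same colour do not cross. For a vertex $v$ of degree $2k$ with neighbours labelled $(u_1,\dots,u_k,u_{ -1},\dots,u_{ -k})$ in clockwise order around $v$, let $R(v)$ be the set of $4k$ open rays from $v$ through each neighbour $u_i$ together with their opposite open rays, in clockwise order around $v$ (in a general position drawing). $v$ is balanced if, for each $i\in I$, the ray from $v$ through $u_i$ and the ray opposite to the ray from $v$ through $u_{ -i}$ are consecutive in $R(v)$. For a $2k$-tree whose edges are coloured $1,\dots,k$ with same-coloured edges non-crossing, a $2k$-simplicial vertex $v$ is a fan if, for some such labelling of its neighbours, $v$ is balanced and each edge $vu_i$ has colour $|i|$ ($i\in I$). A drawing $\phi$ of a $2k$-tree $G$ is good if: $\phi$ is a general position geometric drawing; $\phi$ has thickness $k$; if $G\simeq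 K_{2k+1}$ then at least one vertex is a fan in $\phi$; and if $G\not\simeq K_{2k+1}$ then every $2k$-simplicial vertex of $G$ is a fan in $\phi$.
   Formalization: Geometric drawings, both the good drawing φ and the drawing φ′ obtained by inserting w, place their vertices at points of ℚ² in place of ℝ². -}

module Defs where

open import Data.Nat as ℕ using (ℕ; zero; suc)
open import Data.Bool using (Bool; true; false; T; if_then_else_)
open import Data.Fin using (Fin; zero; suc; punchIn; toℕ; _↑ˡ_; _↑ʳ_)
open import Data.List using (List; map; allFin)
open import Data.Nat.ListAction using (sum)
open import Data.Product using (Σ; ∃; _×_; _,_; proj₁; proj₂)
open import Data.Sum using (_⊎_)
open import Data.Rational using (ℚ; 0ℚ; _<_; _+_; _*_; _-_; -_)
open import Relation.Binary.PropositionalEquality using (_≡_; _≢_; refl; sym; trans)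
open import Relation.Nullary using (¬_)

record Graph (n : ℕ) : Set where
  field
    adj  : Fin n → Fin n → Bool
    symm : ∀ i j → adj i j ≡ adj j i
    irr  : ∀ i → adj i i ≡ false
open Graph public

Edge : ∀ {n} → Graph n → Fin n → Fin n → Set
Edge G i j = T (adj G i j)

delete : ∀ {n} → Graph (suc n) → Fin (suc n) → Graph n
delete G v = record
  { adj  = λ i j → adj G (punchIn v i) (punchIn v j)
  ; symm = λ i j → symm G (punchIn v i) (punchIn v j)
  ; irr  = λ i → irr G (punchIn v i) }

-- G' : add a new vertex (index zero) adjacent exactly to N_G(v);
-- old vertex i becomes suc i.
addOnto : ∀ {n} → Graph n → Fin n → Graph (suc n)
addOnto {n} G v = record { adj = a ; symm = s ; irr = r }
  where
  a : Fin (suc n) → Fin (suc n) → Bool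
  a zero    zero    = false
  a zero    (suc j) = adj G v j
  a (suc i) zero    = adj G v i
  a (suc i) (suc j) = adj G i j
  s : ∀ i j → a i j ≡ a j i
  s zero    zero    = refl
  s zero    (suc j) = refl
  s (suc i) zero    = refl
  s (suc i) (suc j) = symm G i j
  r : ∀ i → a i i ≡ false
  r zero    = refl
  r (suc i) = irr G i

degree : ∀ {n} → Graph n → Fin n → ℕ
degree {n} G v = sum (map (λ u → if adj G v u then 1 else 0) (allFin n))

Complete : ∀ {n} → Graph n → Set
Complete {n} G = ∀ (i j : Fin n) → i ≢ j → Edge G i j

IsoComplete : ∀ {n} → Graph n → ℕ → Set
IsoComplete {n} G m = (n ≡ m) × Complete G

Simplicial : ∀ {n} → ℕ → Graph n → Fin n → Set
Simplicial {n} d G v =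
  (degree G v ≡ d) ×
  (∀ (a b : Fin n) → Edge G v a → Edge G v b → a ≢ b → Edge G a b)

data KTree (d : ℕ) : {n : ℕ} → Graph n → Set where
  base : (G : Graph (suc d)) → Complete G → KTree d G
  step : ∀ {n} (G : Graph (suc n)) (v : Fin (suc n)) →
         Simplicial d G v → KTree d (delete G v) → KTree d G

Pt : Set
Pt = ℚ × ℚ

vec : Pt → Pt → Pt
vec (ax , ay) (bx , by) = (bx - ax , by - ay)

neg : Pt → Pt
neg (x , y) = (- x , - y)

cross : Pt → Pt → ℚ
cross (x₁ , y₁) (x₂ , y₂) = (x₁ * y₂) - (y₁ * x₂)

orient : Pt → Pt → Pt → ℚ
orient a b c = cross (vec a b) (vec a c)

along : Pt → Pt → ℚ → Pt
along (ax , ay) (bx , by) s = (ax + s * (bx - ax) , ay + s * (by - ay))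

Crosses : Pt → Pt → Pt → Pt → Set
Crosses a b c d = Σ ℚ λ s → Σ ℚ λ t →
  (0ℚ < s) × (s < Data.Rational.1ℚ) × (0ℚ < t) × (t < Data.Rational.1ℚ) ×
  (along a b s ≡ along c d t)

Drawing : ℕ → Set
Drawing n = Fin n → Pt

GeneralPosition : ∀ {n} → Drawing n → Set
GeneralPosition {n} φ =
  (∀ (a b : Fin n) → φ a ≡ φ b → a ≡ b) ×
  (∀ (a b c : Fin n) → a ≢ b → b ≢ c → a ≢ c → orient (φ a) (φ b) (φ c) ≢ 0ℚ)

-- edge colouring with colours Fin k (colour j+1 of the paper is j here)
Colouring : ℕ → ℕ → Set
Colouring n k = Fin n → Fin n → Fin k

ThicknessColouring : ∀ {n k} → Graph n → Drawing n → Colouring n k → Set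
ThicknessColouring {n} G φ col =
  (∀ (a b : Fin n) → Edge G a b → col a b ≡ col b a) ×
  (∀ (a b c d : Fin n) → Edge G a b → Edge G c d →
     ¬ ((a ≡ c) × (b ≡ d)) → ¬ ((a ≡ d) × (b ≡ c)) →
     col a b ≡ col c d → ¬ Crosses (φ a) (φ b) (φ c) (φ d))

-- direction has counter-clockwise angle from the positive x-axis in [0, π)
Upper : Pt → Set
Upper (x , y) = (0ℚ < y) ⊎ ((y ≡ 0ℚ) × (0ℚ < x))

-- angle(a) < angle(b), angles measured counter-clockwise in [0, 2π)
AngLt : Pt → Pt → Set
AngLt a b = (Upper a × ¬ Upper b) ⊎
            (((Upper a × Upper b) ⊎ (¬ Upper a × ¬ Upper b)) × (0ℚ < cross a b))

-- s lies strictly inside the open arc swept clockwise from r to r'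
CwBetween : Pt → Pt → Pt → Set
CwBetween r s r' =
  (AngLt s r × AngLt r' s) ⊎ (AngLt r' s × AngLt r r') ⊎ (AngLt r r' × AngLt s r)

module _ {n : ℕ} (G : Graph n) (φ : Drawing n) (v : Fin n) where

  dir : Fin n → Pt
  dir u = vec (φ v) (φ u)

  InR : Pt → Set
  InR d = Σ (Fin n) λ u → Edge G v u × ((d ≡ dir u) ⊎ (d ≡ neg (dir u)))

  ConsecutiveR : Pt → Pt → Set
  ConsecutiveR r r' =
    (∀ s → InR s → ¬ CwBetween r s r') ⊎ (∀ s → InR s → ¬ CwBetween r' s r)

  ClockwiseLabelling : (m : ℕ) → (Fin m → Fin n) → Set
  ClockwiseLabelling m L =
    (∀ p q → L p ≡ L q → p ≡ q) ×
    (∀ p → Edge G v (L p)) ×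
    (∀ u → Edge G v u → Σ (Fin m) λ p → L p ≡ u) ×
    (∀ (p q : Fin m) →
       ((toℕ q ≡ suc (toℕ p)) ⊎ ((toℕ q ≡ 0) × (suc (toℕ p) ≡ m))) →
       ∀ u → Edge G v u → ¬ CwBetween (dir (L p)) (dir u) (dir (L q)))

  module _ (k : ℕ) (L : Fin (k ℕ.+ k) → Fin n) where
    -- u_{j+1} and u_{-(j+1)} for j : Fin k
    uPos uNeg : Fin k → Fin n
    uPos j = L (j ↑ˡ k)
    uNeg j = L (k ↑ʳ j)

    Balanced : Set
    Balanced = ∀ (j : Fin k) →
      ConsecutiveR (dir (uPos j)) (neg (dir (uNeg j))) ×
      ConsecutiveR (dir (uNeg j)) (neg (dir (uPos j)))

  Fan : (k : ℕ) → Colouring n k → Set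
  Fan k col =
    Simplicial (2 ℕ.* k) G v ×
    Σ (Fin (k ℕ.+ k) → Fin n) λ L →
      ClockwiseLabelling (k ℕ.+ k) L × Balanced k L ×
      (∀ (j : Fin k) → (col v (uPos k L j) ≡ j) × (col v (uNeg k L j) ≡ j))

Good : ∀ {n} (k : ℕ) → Graph n → Drawing n → Colouring n k → Set
Good {n} k G φ col =
  GeneralPosition φ ×
  ThicknessColouring G φ col ×
  (IsoComplete G (suc (2 ℕ.* k)) → Σ (Fin n) λ v → Fan G φ v k col) ×
  (¬ IsoComplete G (suc (2 ℕ.* k)) →
     ∀ v → Simplicial (2 ℕ.* k) G v → Fan G φ v k col)

-- Place the new vertex w on the line through v in a direction d that separates, for every colour j,
-- the two neighbours u_j and u_{-j} of v (d is the ray to u_1 turned slightly towards u_{-1}; balance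
-- at v makes the line through u_1 separate the other pairs), and so close to v that w sees every pair
-- of old vertices in the same orientation as v. Giving wb the colour of vb, an edge wb can then only
-- cross an edge of its own colour if vb does, or if that edge is vb′ with b′ the partner of b, which
-- lies on the other side of the line. Since w sees the neighbours of v in the same cyclic order and
-- with the same opposite rays as v, w is a balanced fan, and the other fans are untouched because w is
-- adjacent to none of them. All sign conditions are perturbations of finitely many non-zero
-- orientations, and the cyclic order of rays is recovered from orientation signs alone.
module Submission where

open import Defs
open import Data.Bool using (Bool; true; false; T; not; _∧_; _∨_; if_then_else_)
import Data.Bool as Bool
open import Data.Bool.Properties using (T-∧; T-∨; T-not-≡)
open import Data.Empty using (⊥; ⊥-elim)
open import Data.Fin using (Fin; zero; suc; combine; remQuot; _↑ˡ_; _↑ʳ_; splitAt; join; toℕ)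
open import Data.Fin.Properties using (remQuot-combine; suc-injective; ↑ˡ-injective; splitAt-↑ˡ; splitAt-↑ʳ; join-splitAt)
import Data.Fin.Properties as Finₚ
open import Data.List using (map; allFin)
open import Data.List.Properties using (map-tabulate)
open import Data.Nat using (ℕ; s≤s)
import Data.Nat as ℕ
import Data.Nat.Properties as ℕₚ
open import Data.Nat.ListAction using (sum)
open import Data.Product using (Σ; ∃; _×_; _,_; proj₁; proj₂; uncurry)
open import Data.Product.Function.NonDependent.Propositional using (_×-⇔_)
open import Data.Rational using (ℚ; 0ℚ; 1ℚ; _<_; _≤_; _+_; _*_; _-_; -_; ∣_∣; 1/_; _⊓_; NonZero; ≢-nonZero; positive; negative; nonNegative)
open import Data.Rational.Properties using (_≟_; <-cmp; <-irrefl; <-asym; <⇒≤; <-≤-trans; ≤-reflexive; ≤-trans; neg-antimono-<; neg-injective; +-mono-≤; +-mono-<-≤; +-mono-≤-<; +-monoˡ-≤; +-monoˡ-<; +-identityˡ; +-identityʳ; +-inverseʳ; *-zeroˡ; *-zeroʳ; *-assoc; *-identityʳ; *-inverseˡ; *-inverseʳ; *-monoʳ-≤-nonNeg; positive⁻¹; negative⁻¹; nonNegative⁻¹; pos+pos⇒pos; neg+neg⇒neg; pos*pos⇒pos; pos*neg⇒neg; neg*pos⇒neg; neg*neg⇒pos; nonNeg*nonNeg⇒nonNeg; pos⇒nonZero; 1/pos⇒pos; ∣p∣≡p∨∣p∣≡-p; ∣p∣≡p⇒0≤p; 0≤p⇒∣p∣≡p; ∣-p∣≡∣p∣; ∣p∣≡0⇒p≡0;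 0≤∣p∣; ⊓-sel; p⊓q≤p; p⊓q≤q)
open import Data.Rational.Solver using (module +-*-Solver)
open import Data.Sum using (_⊎_; inj₁; inj₂; [_,_]′)
open import Data.Sum.Function.Propositional using (_⊎-⇔_)
open import Data.Unit using (tt)
open import Function using (_∘_; id)
open import Function.Bundles using (_⇔_; mk⇔; Equivalence)
open import Function.Construct.Composition using (_⇔-∘_)
open import Function.Construct.Symmetry using (⇔-sym)
open import Relation.Binary.Definitions using (tri<; tri≈; tri>)
open import Relation.Binary.PropositionalEquality
open import Relation.Nullary using (¬_; Dec; yes; no)
open import Relation.Nullary.Decidable using (⌊_⌋; toWitness)

open +-*-Solver
open Equivalence using (to; from)

data Sign : Set where
  plus nil minus : Sign

-ˢ_ : Sign → Sign
-ˢ plus  = minus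
-ˢ nil   = nil
-ˢ minus = plus

_*ˢ_ : Sign → Sign → Sign
plus  *ˢ σ = σ
nil   *ˢ _ = nil
minus *ˢ σ = -ˢ σ

-ˢ-involutive : ∀ σ → -ˢ (-ˢ σ) ≡ σ
-ˢ-involutive plus  = refl
-ˢ-involutive nil   = refl
-ˢ-involutive minus = refl

-ˢ-opposite : ∀ {σ τ} → σ ≡ -ˢ τ → τ ≡ -ˢ σ
-ˢ-opposite {τ = τ} refl = sym (-ˢ-involutive τ)

-ˢ≢nil : ∀ {σ} → σ ≢ nil → -ˢ σ ≢ nil
-ˢ≢nil {plus}  _ ()
-ˢ≢nil {nil}   h = h
-ˢ≢nil {minus} _ ()

σ≡-ˢσ⇒σ≡nil : ∀ {σ} → σ ≡ -ˢ σ → σ ≡ nil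
σ≡-ˢσ⇒σ≡nil {nil} _ = refl

HasSign : ℚ → Sign → Set
HasSign x plus  = 0ℚ < x
HasSign x nil   = x ≡ 0ℚ
HasSign x minus = x < 0ℚ

-- abstract, so that sgn never unfolds into a comparison of normalised numerators during type checking
abstract
  sgn : ℚ → Sign
  sgn x with <-cmp 0ℚ x
  ... | tri< _ _ _ = plus
  ... | tri≈ _ _ _ = nil
  ... | tri> _ _ _ = minus

  sgn-sound : ∀ x → HasSign x (sgn x)
  sgn-sound x with <-cmp 0ℚ x
  ... | tri< 0<x _ _ = 0<x
  ... | tri≈ _ 0≡x _ = sym 0≡x
  ... | tri> _ _ x<0 = x<0

  sgn-complete : ∀ {x} σ → HasSign x σ → sgn x ≡ σ
  sgn-complete {x} σ h with <-cmp 0ℚ x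
  sgn-complete plus  _   | tri< _ _ _   = refl
  sgn-complete nil   x≡0 | tri< 0<x _ _ = ⊥-elim (<-irrefl (sym x≡0) 0<x)
  sgn-complete minus x<0 | tri< 0<x _ _ = ⊥-elim (<-asym 0<x x<0)
  sgn-complete plus  0<x | tri≈ _ 0≡x _ = ⊥-elim (<-irrefl 0≡x 0<x)
  sgn-complete nil   _   | tri≈ _ _ _   = refl
  sgn-complete minus x<0 | tri≈ _ 0≡x _ = ⊥-elim (<-irrefl (sym 0≡x) x<0)
  sgn-complete plus  0<x | tri> _ _ x<0 = ⊥-elim (<-asym 0<x x<0)
  sgn-complete nil   x≡0 | tri> _ _ x<0 = ⊥-elim (<-irrefl x≡0 x<0)
  sgn-complete minus _   | tri> _ _ _   = refl

sgn-0 : sgn 0ℚ ≡ nil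
sgn-0 = sgn-complete nil refl

sgn≡nil⇒≡0 : ∀ {x} → sgn x ≡ nil → x ≡ 0ℚ
sgn≡nil⇒≡0 {x} e = subst (HasSign x) e (sgn-sound x)

sgn≡plus⇒pos : ∀ {x} → sgn x ≡ plus → 0ℚ < x
sgn≡plus⇒pos {x} e = subst (HasSign x) e (sgn-sound x)

≢0⇒sgn≢nil : ∀ {x} → x ≢ 0ℚ → sgn x ≢ nil
≢0⇒sgn≢nil x≢0 = x≢0 ∘ sgn≡nil⇒≡0

sgn-≡⇒≢0 : ∀ {x y} → sgn x ≡ sgn y → y ≢ 0ℚ → x ≢ 0ℚ
sgn-≡⇒≢0 {x} {y} e y≢0 x≡0 = ≢0⇒sgn≢nil y≢0 (trans (sym e) (trans (cong sgn x≡0) sgn-0))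

sgn-neg : ∀ x → sgn (- x) ≡ -ˢ sgn x
sgn-neg x = sgn-complete (-ˢ sgn x) (negated (sgn x) (sgn-sound x))
  where
  negated : ∀ σ → HasSign x σ → HasSign (- x) (-ˢ σ)
  negated plus  0<x  = neg-antimono-< 0<x
  negated nil   refl = refl
  negated minus x<0  = neg-antimono-< x<0

sgn-* : ∀ x y → sgn (x * y) ≡ sgn x *ˢ sgn y
sgn-* x y = sgn-complete (sgn x *ˢ sgn y) (product (sgn x) (sgn y) (sgn-sound x) (sgn-sound y))
  where
  product : ∀ σ τ → HasSign x σ → HasSign y τ → HasSign (x * y) (σ *ˢ τ)
  product nil   _     refl _    = *-zeroˡ y
  product plus  nil   _    refl = *-zeroʳ x
  product minus nil   _    refl = *-zeroʳ x
  product plus  plus  a    b    = positive⁻¹ _ {{pos*pos⇒pos x {{positive a}} y {{positive b}}}}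
  product plus  minus a    b    = negative⁻¹ _ {{pos*neg⇒neg x {{positive a}} y {{negative b}}}}
  product minus plus  a    b    = negative⁻¹ _ {{neg*pos⇒neg x {{negative a}} y {{positive b}}}}
  product minus minus a    b    = positive⁻¹ _ {{neg*neg⇒pos x {{negative a}} y {{negative b}}}}

sgn-*-pos : ∀ {c} x → 0ℚ < c → sgn (c * x) ≡ sgn x
sgn-*-pos {c} x 0<c = trans (sgn-* c x) (cong (_*ˢ sgn x) (sgn-complete plus 0<c))

sgn-+-same : ∀ {x y σ} → sgn x ≡ σ → sgn y ≡ σ → sgn (x + y) ≡ σ
sgn-+-same {x} {y} {σ} refl e = sgn-complete σ (sum-of (sgn x) (sgn-sound x) (subst (HasSign y) e (sgn-sound y)))
  where
  sum-of : ∀ σ → HasSign x σ → HasSign y σ → HasSign (x + y) σ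
  sum-of plus  a    b    = positive⁻¹ _ {{pos+pos⇒pos x {{positive a}} y {{positive b}}}}
  sum-of nil   refl refl = refl
  sum-of minus a    b    = negative⁻¹ _ {{neg+neg⇒neg x {{negative a}} y {{negative b}}}}

sgn-difference : ∀ {x y} → sgn y ≡ -ˢ sgn x → sgn (x - y) ≡ sgn x
sgn-difference {x} {y} opp = sgn-+-same refl (trans (sgn-neg y) (sym (-ˢ-opposite opp)))

same-sgn⇒0<* : ∀ {x y σ} → sgn x ≡ σ → sgn y ≡ σ → σ ≢ nil → 0ℚ < x * y
same-sgn⇒0<* {x} {y} {σ} ex ey σ≢nil = sgn≡plus⇒pos (trans (sgn-* x y) (square σ ex ey σ≢nil))
  where
  square : ∀ σ → sgn x ≡ σ → sgn y ≡ σ → σ ≢ nil → sgn x *ˢ sgn y ≡ plus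
  square plus  ex ey _      rewrite ex | ey = refl
  square nil   _  _  σ≢nil  = ⊥-elim (σ≢nil refl)
  square minus ex ey _      rewrite ex | ey = refl

sgn-1/ : ∀ x .{{_ : NonZero x}} → sgn (1/ x) ≡ sgn x
sgn-1/ x = inverse (sgn x) (trans (sym (sgn-* x (1/ x))) (trans (cong sgn (*-inverseʳ x)) (sgn-complete plus (positive⁻¹ 1ℚ))))
  where
  inverse : ∀ σ {τ} → σ *ˢ τ ≡ plus → τ ≡ σ
  inverse plus  e = e
  inverse minus {minus} _ = refl

0≤q+∣q∣ : ∀ q → 0ℚ ≤ q + ∣ q ∣
0≤q+∣q∣ q with ∣p∣≡p∨∣p∣≡-p q
... | inj₁ ∣q∣≡q  = subst (λ z → 0ℚ ≤ q + z) (sym ∣q∣≡q) (+-mono-≤ 0≤q 0≤q)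
  where 0≤q = ∣p∣≡p⇒0≤p ∣q∣≡q
... | inj₂ ∣q∣≡-q = subst (λ z → 0ℚ ≤ q + z) (sym ∣q∣≡-q) (≤-reflexive (sym (+-inverseʳ q)))

0≤q-p : ∀ {p q} → p ≤ q → 0ℚ ≤ q - p
0≤q-p {p} {q} p≤q = subst (_≤ q - p) (+-inverseʳ p) (+-monoˡ-≤ (- p) p≤q)

0<∣p∣ : ∀ {p} → p ≢ 0ℚ → 0ℚ < ∣ p ∣
0<∣p∣ {p} p≢0 with <-cmp 0ℚ ∣ p ∣
... | tri< 0<∣p∣ _ _ = 0<∣p∣
... | tri≈ _ 0≡∣p∣ _ = ⊥-elim (p≢0 (∣p∣≡0⇒p≡0 p (sym 0≡∣p∣)))
... | tri> _ _ ∣p∣<0 = ⊥-elim (<-irrefl refl (<-≤-trans ∣p∣<0 (0≤∣p∣ p)))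

0<∣q∣+1 : ∀ q → 0ℚ < ∣ q ∣ + 1ℚ
0<∣q∣+1 q = +-mono-≤-< (0≤∣p∣ q) (positive⁻¹ 1ℚ)

-- p + ε q = (p - ε (∣q∣ + 1)) + ε (q + ∣q∣) + ε, a sum of two non-negative terms and a positive one
perturb-pos : ∀ {p q ε} → 0ℚ < ε → ε * (∣ q ∣ + 1ℚ) ≤ ∣ p ∣ → 0ℚ < p → 0ℚ < p + ε * q
perturb-pos {p} {q} {ε} 0<ε small 0<p =
  subst (0ℚ <_) (sym split) (+-mono-≤-< (+-mono-≤ slack (0≤* (<⇒≤ 0<ε) (0≤q+∣q∣ q))) 0<ε)
  where
  split : p + ε * q ≡ ((p - ε * (∣ q ∣ + 1ℚ)) + ε * (q + ∣ q ∣)) + ε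
  split = solve 4 (λ p q ε a → p :+ ε :* q := ((p :- ε :* (a :+ con 1ℚ)) :+ ε :* (q :+ a)) :+ ε)
            refl p q ε ∣ q ∣
  slack : 0ℚ ≤ p - ε * (∣ q ∣ + 1ℚ)
  slack = 0≤q-p (subst (ε * (∣ q ∣ + 1ℚ) ≤_) (0≤p⇒∣p∣≡p (<⇒≤ 0<p)) small)
  0≤* : ∀ {x y} → 0ℚ ≤ x → 0ℚ ≤ y → 0ℚ ≤ x * y
  0≤* {x} {y} 0≤x 0≤y = nonNegative⁻¹ _ {{nonNeg*nonNeg⇒nonNeg x {{nonNegative 0≤x}} y {{nonNegative 0≤y}}}}

sgn-perturb : ∀ {p q ε} → 0ℚ < ε → ε * (∣ q ∣ + 1ℚ) ≤ ∣ p ∣ → p ≢ 0ℚ → sgn (p + ε * q) ≡ sgn p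
sgn-perturb {p} {q} {ε} 0<ε small p≢0 = by-sign (sgn p) (sgn-sound p)
  where
  open ≡-Reasoning
  small′ : ε * (∣ - q ∣ + 1ℚ) ≤ ∣ - p ∣
  small′ = subst₂ (λ a b → ε * (a + 1ℚ) ≤ b) (sym (∣-p∣≡∣p∣ q)) (sym (∣-p∣≡∣p∣ p)) small
  by-sign : ∀ σ → HasSign p σ → sgn (p + ε * q) ≡ σ
  by-sign plus  0<p = sgn-complete plus (perturb-pos 0<ε small 0<p)
  by-sign nil   p≡0 = ⊥-elim (p≢0 p≡0)
  by-sign minus p<0 = begin
    sgn (p + ε * q)          ≡⟨ sym (-ˢ-involutive _) ⟩
    -ˢ (-ˢ sgn (p + ε * q))  ≡⟨ cong -ˢ_ (sym (sgn-neg _)) ⟩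
    -ˢ sgn (- (p + ε * q))   ≡⟨ cong (-ˢ_ ∘ sgn) (solve 3 (λ p q ε → :- (p :+ ε :* q) := :- p :+ ε :* (:- q)) refl p q ε) ⟩
    -ˢ sgn (- p + ε * - q)   ≡⟨ cong -ˢ_ (sgn-complete plus (perturb-pos 0<ε small′ (neg-antimono-< p<0))) ⟩
    minus                    ∎

1/[∣q∣+1] : ℚ → ℚ
1/[∣q∣+1] q = (1/ (∣ q ∣ + 1ℚ)) {{pos⇒nonZero (∣ q ∣ + 1ℚ) {{positive (0<∣q∣+1 q)}}}}

0<1/[∣q∣+1] : ∀ q → 0ℚ < 1/[∣q∣+1] q
0<1/[∣q∣+1] q = positive⁻¹ _ {{1/pos⇒pos (∣ q ∣ + 1ℚ) {{positive (0<∣q∣+1 q)}}}}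

-- ∣p∣ / (∣q∣ + 1); for p = 0 no step size is constrained and any positive value will do
admissibleStep : ℚ → ℚ → ℚ
admissibleStep p q with p ≟ 0ℚ
... | yes _ = 1ℚ
... | no  _ = ∣ p ∣ * 1/[∣q∣+1] q

admissibleStep-pos : ∀ p q → 0ℚ < admissibleStep p q
admissibleStep-pos p q with p ≟ 0ℚ
... | yes _   = positive⁻¹ 1ℚ
... | no  p≢0 = positive⁻¹ _ {{pos*pos⇒pos ∣ p ∣ {{positive (0<∣p∣ p≢0)}} (1/[∣q∣+1] q)
                  {{positive (0<1/[∣q∣+1] q)}}}}

admissibleStep-small : ∀ {p q ε} → p ≢ 0ℚ → ε ≤ admissibleStep p q → ε * (∣ q ∣ + 1ℚ) ≤ ∣ p ∣
admissibleStep-small {p} {q} {ε} p≢0 ε≤ with p ≟ 0ℚ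
... | yes p≡0 = ⊥-elim (p≢0 p≡0)
... | no  _   = ≤-trans (*-monoʳ-≤-nonNeg c {{nonNegative (<⇒≤ (0<∣q∣+1 q))}} ε≤) (≤-reflexive (begin
  ∣ p ∣ * 1/[∣q∣+1] q * c    ≡⟨ *-assoc ∣ p ∣ _ c ⟩
  ∣ p ∣ * (1/[∣q∣+1] q * c)  ≡⟨ cong (∣ p ∣ *_) (*-inverseˡ c {{pos⇒nonZero c {{positive (0<∣q∣+1 q)}}}}) ⟩
  ∣ p ∣ * 1ℚ                 ≡⟨ *-identityʳ ∣ p ∣ ⟩
  ∣ p ∣                      ∎))
  where
  open ≡-Reasoning
  c = ∣ q ∣ + 1ℚ

minimum : ∀ {m} → (Fin m → ℚ) → ℚ
minimum {ℕ.zero}  f = 1ℚ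
minimum {ℕ.suc m} f = f zero ⊓ minimum (f ∘ suc)

minimum-pos : ∀ {m} (f : Fin m → ℚ) → (∀ i → 0ℚ < f i) → 0ℚ < minimum f
minimum-pos {ℕ.zero}  f pos = positive⁻¹ 1ℚ
minimum-pos {ℕ.suc m} f pos with ⊓-sel (f zero) (minimum (f ∘ suc))
... | inj₁ e = subst (0ℚ <_) (sym e) (pos zero)
... | inj₂ e = subst (0ℚ <_) (sym e) (minimum-pos (f ∘ suc) (pos ∘ suc))

minimum-≤ : ∀ {m} (f : Fin m → ℚ) i → minimum f ≤ f i
minimum-≤ f zero    = p⊓q≤p (f zero) _
minimum-≤ f (suc i) = ≤-trans (p⊓q≤q (f zero) _) (minimum-≤ (f ∘ suc) i)

small-perturbation : ∀ {m} (p q : Fin m → ℚ) →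
  ∃ λ ε → 0ℚ < ε × (∀ i → p i ≢ 0ℚ → sgn (p i + ε * q i) ≡ sgn (p i))
small-perturbation p q = ε , 0<ε ,
  λ i p≢0 → sgn-perturb 0<ε (admissibleStep-small p≢0 (minimum-≤ steps i)) p≢0
  where
  steps = λ i → admissibleStep (p i) (q i)
  ε = minimum steps
  0<ε = minimum-pos steps (λ i → admissibleStep-pos (p i) (q i))

small-perturbation₂ : ∀ {m} (p q : Fin m → Fin m → ℚ) →
  ∃ λ ε → 0ℚ < ε × (∀ i j → p i j ≢ 0ℚ → sgn (p i j + ε * q i j) ≡ sgn (p i j))
small-perturbation₂ {m} p q with small-perturbation (uncurry p ∘ remQuot m) (uncurry q ∘ remQuot m)
... | ε , 0<ε , preserved = ε , 0<ε , λ i j →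
  subst (λ ij → uncurry p ij ≢ 0ℚ → sgn (uncurry p ij + ε * uncurry q ij) ≡ sgn (uncurry p ij))
        (remQuot-combine i j) (preserved (combine i j))

0ᵥ : Pt
0ᵥ = (0ℚ , 0ℚ)

_+ᵥ_ : Pt → Pt → Pt
(x , y) +ᵥ (x′ , y′) = (x + x′ , y + y′)

_·ᵥ_ : ℚ → Pt → Pt
c ·ᵥ (x , y) = (c * x , c * y)

infixl 6 _+ᵥ_
infixl 7 _·ᵥ_

signed : Bool → Pt → Pt
signed false p = p
signed true  p = neg p

neg≡0ᵥ : ∀ {p} → neg p ≡ 0ᵥ → p ≡ 0ᵥ
neg≡0ᵥ {x , y} e = cong₂ _,_ (neg-injective (cong proj₁ e)) (neg-injective (cong proj₂ e))

signed≢0ᵥ : ∀ b {p} → p ≢ 0ᵥ → signed b p ≢ 0ᵥ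
signed≢0ᵥ false p≢0 = p≢0
signed≢0ᵥ true  p≢0 = p≢0 ∘ neg≡0ᵥ

vec≡0ᵥ : ∀ {a b} → vec a b ≡ 0ᵥ → b ≡ a
vec≡0ᵥ {ax , ay} {bx , by} e = cong₂ _,_ (coordinate (cong proj₁ e)) (coordinate (cong proj₂ e))
  where
  coordinate : ∀ {x y} → y - x ≡ 0ℚ → y ≡ x
  coordinate {x} {y} d = trans (solve 2 (λ x y → y := (y :- x) :+ x) refl x y) (trans (cong (_+ x) d) (+-identityˡ x))

cross-antisym : ∀ p q → cross q p ≡ - cross p q
cross-antisym (a , b) (c , d) = solve 4 (λ a b c d → c :* b :- d :* a := :- (a :* d :- b :* c)) refl a b c d

cross-self : ∀ p → cross p p ≡ 0ℚ
cross-self (a , b) = solve 2 (λ a b → a :* b :- b :* a := con 0ℚ) refl a b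

cross-negˡ : ∀ p q → cross (neg p) q ≡ - cross p q
cross-negˡ (a , b) (c , d) = solve 4 (λ a b c d → (:- a) :* d :- (:- b) :* c := :- (a :* d :- b :* c)) refl a b c d

cross-negʳ : ∀ p q → cross p (neg q) ≡ - cross p q
cross-negʳ (a , b) (c , d) = solve 4 (λ a b c d → a :* (:- d) :- b :* (:- c) := :- (a :* d :- b :* c)) refl a b c d

cross-linearˡ : ∀ p h q r → cross (p +ᵥ h ·ᵥ q) r ≡ cross p r + h * cross q r
cross-linearˡ (a , b) h (c , d) (e , f) = solve 7 (λ a b h c d e f →
  (a :+ h :* c) :* f :- (b :+ h :* d) :* e := (a :* f :- b :* e) :+ h :* (c :* f :- d :* e)) refl a b h c d e f

flipˢ : Bool → Sign → Sign
flipˢ false σ = σ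
flipˢ true  σ = -ˢ σ

sgn-cross-signed : ∀ b b′ p q → sgn (cross (signed b p) (signed b′ q)) ≡ flipˢ b (flipˢ b′ (sgn (cross p q)))
sgn-cross-signed false false p q = refl
sgn-cross-signed true  false p q = trans (cong sgn (cross-negˡ p q)) (sgn-neg _)
sgn-cross-signed false true  p q = trans (cong sgn (cross-negʳ p q)) (sgn-neg _)
sgn-cross-signed true  true  p q =
  trans (cong sgn (cross-negˡ p (neg q))) (trans (sgn-neg _) (cong -ˢ_ (sgn-cross-signed false true p q)))

cross-signed≢0 : ∀ b b′ {p q} → cross p q ≢ 0ℚ → cross (signed b p) (signed b′ q) ≢ 0ℚ
cross-signed≢0 b b′ {p} {q} pq≢0 e = flipˢ≢nil b (flipˢ≢nil b′ (≢0⇒sgn≢nil pq≢0))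
  (trans (sym (sgn-cross-signed b b′ p q)) (trans (cong sgn e) sgn-0))
  where
  flipˢ≢nil : ∀ b {σ} → σ ≢ nil → flipˢ b σ ≢ nil
  flipˢ≢nil false = id
  flipˢ≢nil true  = -ˢ≢nil

orientᴾ : ∀ {m} → Polynomial m → Polynomial m → Polynomial m → Polynomial m → Polynomial m → Polynomial m → Polynomial m
orientᴾ ax ay bx by cx cy = (bx :- ax) :* (cy :- ay) :- (by :- ay) :* (cx :- ax)

orient-rotate : ∀ a b c → orient a b c ≡ orient b c a
orient-rotate (ax , ay) (bx , by) (cx , cy) = solve 6 (λ ax ay bx by cx cy →
  orientᴾ ax ay bx by cx cy := orientᴾ bx by cx cy ax ay) refl ax ay bx by cx cy

orient-swap : ∀ a b c → orient a c b ≡ - orient a b c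
orient-swap (ax , ay) (bx , by) (cx , cy) = solve 6 (λ ax ay bx by cx cy →
  orientᴾ ax ay cx cy bx by := :- orientᴾ ax ay bx by cx cy) refl ax ay bx by cx cy

orient-repeat : ∀ a b → orient a b b ≡ 0ℚ
orient-repeat a b = cross-self (vec a b)

orient-repeat₁ : ∀ a c → orient a a c ≡ 0ℚ
orient-repeat₁ a c = trans (orient-rotate a a c) (trans (orient-rotate a c a) (orient-repeat c a))

orient-repeat₂ : ∀ a b → orient a b a ≡ 0ℚ
orient-repeat₂ a b = trans (orient-rotate a b a) (orient-repeat b a)

orient-displace : ∀ a ε d b c → orient (a +ᵥ ε ·ᵥ d) b c ≡ orient a b c + ε * (- cross d (vec b c))
orient-displace (ax , ay) ε (dx , dy) (bx , by) (cx , cy) = solve 9 (λ ax ay ε dx dy bx by cx cy →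
  orientᴾ (ax :+ ε :* dx) (ay :+ ε :* dy) bx by cx cy
  := orientᴾ ax ay bx by cx cy :+ ε :* (:- (dx :* (cy :- by) :- dy :* (cx :- bx))))
  refl ax ay ε dx dy bx by cx cy

orient-displace-from : ∀ a ε d b → orient (a +ᵥ ε ·ᵥ d) b a ≡ ε * cross d (vec a b)
orient-displace-from (ax , ay) ε (dx , dy) (bx , by) = solve 7 (λ ax ay ε dx dy bx by →
  orientᴾ (ax :+ ε :* dx) (ay :+ ε :* dy) bx by ax ay := ε :* (dx :* (by :- ay) :- dy :* (bx :- ax)))
  refl ax ay ε dx dy bx by

orient-along : ∀ a b c d t → orient a b (along c d t) ≡ (1ℚ - t) * orient a b c + t * orient a b d
orient-along (ax , ay) (bx , by) (cx , cy) (dx , dy) t = solve 9 (λ ax ay bx by cx cy dx dy t →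
  orientᴾ ax ay bx by (cx :+ t :* (dx :- cx)) (cy :+ t :* (dy :- cy))
  := (con 1ℚ :- t) :* orientᴾ ax ay bx by cx cy :+ t :* orientᴾ ax ay bx by dx dy) refl ax ay bx by cx cy dx dy t

orient-on-segment : ∀ a b s → orient a b (along a b s) ≡ 0ℚ
orient-on-segment (ax , ay) (bx , by) s = solve 5 (λ ax ay bx by s →
  orientᴾ ax ay bx by (ax :+ s :* (bx :- ax)) (ay :+ s :* (by :- ay)) := con 0ℚ) refl ax ay bx by s

orient-balance : ∀ a b c d → orient c d a - orient c d b ≡ orient a b d - orient a b c
orient-balance (ax , ay) (bx , by) (cx , cy) (dx , dy) = solve 8 (λ ax ay bx by cx cy dx dy →
  orientᴾ cx cy dx dy ax ay :- orientᴾ cx cy dx dy bx by := orientᴾ ax ay bx by dx dy :- orientᴾ ax ay bx by cx cy)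
  refl ax ay bx by cx cy dx dy

-- both sides are (orient c d a - orient c d b) times the intersection point of the lines ab and cd
intersection-identity : ∀ a b c d →
  orient c d a ·ᵥ b +ᵥ (- orient c d b) ·ᵥ a ≡ (- orient a b c) ·ᵥ d +ᵥ (- (- orient a b d)) ·ᵥ c
intersection-identity (ax , ay) (bx , by) (cx , cy) (dx , dy) = cong₂ _,_
  (solve 8 (λ ax ay bx by cx cy dx dy →
     orientᴾ cx cy dx dy ax ay :* bx :+ (:- orientᴾ cx cy dx dy bx by) :* ax
     := (:- orientᴾ ax ay bx by cx cy) :* dx :+ (:- (:- orientᴾ ax ay bx by dx dy)) :* cx) refl ax ay bx by cx cy dx dy)
  (solve 8 (λ ax ay bx by cx cy dx dy →
     orientᴾ cx cy dx dy ax ay :* by :+ (:- orientᴾ cx cy dx dy bx by) :* ay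
     := (:- orientᴾ ax ay bx by cx cy) :* dy :+ (:- (:- orientᴾ ax ay bx by dx dy)) :* cy) refl ax ay bx by cx cy dx dy)

along-as-combination : ∀ a b o o′ i → (o - o′) * i ≡ 1ℚ → along a b (o * i) ≡ i ·ᵥ (o ·ᵥ b +ᵥ (- o′) ·ᵥ a)
along-as-combination (ax , ay) (bx , by) o o′ i Di≡1 = cong₂ _,_ (coordinate ax bx) (coordinate ay by)
  where
  coordinate : ∀ x y → x + (o * i) * (y - x) ≡ i * (o * y + (- o′) * x)
  coordinate x y = begin
    x + (o * i) * (y - x)                               ≡⟨ solve 5 (λ x y o o′ i →
      x :+ (o :* i) :* (y :- x) := x :* (con 1ℚ :- (o :- o′) :* i) :+ i :* (o :* y :+ (:- o′) :* x)) refl x y o o′ i ⟩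
    x * (1ℚ - (o - o′) * i) + i * (o * y + (- o′) * x)  ≡⟨ cong (λ z → x * (1ℚ - z) + i * (o * y + (- o′) * x)) Di≡1 ⟩
    x * 0ℚ + i * (o * y + (- o′) * x)                   ≡⟨ cong (_+ i * (o * y + (- o′) * x)) (*-zeroʳ x) ⟩
    0ℚ + i * (o * y + (- o′) * x)                       ≡⟨ +-identityˡ _ ⟩
    i * (o * y + (- o′) * x)                            ∎
    where open ≡-Reasoning

0<1-t : ∀ {t} → t < 1ℚ → 0ℚ < 1ℚ - t
0<1-t {t} t<1 = subst (_< 1ℚ - t) (+-inverseʳ t) (+-monoˡ-< (- t) t<1)

0<1-t⇒t<1 : ∀ {t} → 0ℚ < 1ℚ - t → t < 1ℚ
0<1-t⇒t<1 {t} 0<1-t = subst₂ _<_ (+-identityˡ t)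
  (solve 1 (λ t → (con 1ℚ :- t) :+ t := con 1ℚ) refl t) (+-monoˡ-< t 0<1-t)

crosses-flipˡ : ∀ {a b c d} → Crosses a b c d → Crosses b a c d
crosses-flipˡ {a , a′} {b , b′} (s , t , 0<s , s<1 , 0<t , t<1 , meet) =
  1ℚ - s , t , 0<1-t s<1 , 0<1-t⇒t<1 (subst (0ℚ <_) (sym 1-[1-s]) 0<s) , 0<t , t<1 ,
  trans (cong₂ _,_ (reverse a b) (reverse a′ b′)) meet
  where
  1-[1-s] = solve 1 (λ s → con 1ℚ :- (con 1ℚ :- s) := s) refl s
  reverse : ∀ x y → y + (1ℚ - s) * (x - y) ≡ x + s * (y - x)
  reverse x y = solve 3 (λ x y s → y :+ (con 1ℚ :- s) :* (x :- y) := x :+ s :* (y :- x)) refl x y s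

crosses-swap : ∀ {a b c d} → Crosses a b c d → Crosses c d a b
crosses-swap (s , t , 0<s , s<1 , 0<t , t<1 , meet) = t , s , 0<t , t<1 , 0<s , s<1 , sym meet

crosses-flipʳ : ∀ {a b c d} → Crosses a b c d → Crosses a b d c
crosses-flipʳ {a} {b} {c} {d} = crosses-swap {d} {c} {a} {b} ∘ crosses-flipˡ {c} {d} {a} {b} ∘ crosses-swap {a} {b} {c} {d}

convex-zero : ∀ {t x y} → 0ℚ < t → t < 1ℚ → (1ℚ - t) * x + t * y ≡ 0ℚ → sgn y ≡ -ˢ sgn x
convex-zero {t} {x} {y} 0<t t<1 comb = begin
  sgn y                   ≡⟨ sym (sgn-*-pos y 0<t) ⟩
  sgn (t * y)             ≡⟨ cong sgn ty≡ ⟩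
  sgn (- ((1ℚ - t) * x))  ≡⟨ sgn-neg _ ⟩
  -ˢ sgn ((1ℚ - t) * x)   ≡⟨ cong -ˢ_ (sgn-*-pos x (0<1-t t<1)) ⟩
  -ˢ sgn x                ∎
  where
  open ≡-Reasoning
  ty≡ : t * y ≡ - ((1ℚ - t) * x)
  ty≡ = trans (solve 3 (λ t x y → t :* y := :- ((con 1ℚ :- t) :* x) :+ ((con 1ℚ :- t) :* x :+ t :* y)) refl t x y)
          (trans (cong (- ((1ℚ - t) * x) +_) comb) (+-identityʳ _))

crosses⇒opposite : ∀ {a b c d} → Crosses a b c d → sgn (orient a b d) ≡ -ˢ sgn (orient a b c)
crosses⇒opposite {a} {b} {c} {d} (s , t , _ , _ , 0<t , t<1 , meet) = convex-zero 0<t t<1 (begin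
  (1ℚ - t) * orient a b c + t * orient a b d  ≡⟨ sym (orient-along a b c d t) ⟩
  orient a b (along c d t)                    ≡⟨ cong (orient a b) (sym meet) ⟩
  orient a b (along a b s)                    ≡⟨ orient-on-segment a b s ⟩
  0ℚ                                          ∎)
  where open ≡-Reasoning

unit-interval : ∀ {x y i σ} → (x + y) * i ≡ 1ℚ → sgn x ≡ σ → sgn y ≡ σ → sgn i ≡ σ → σ ≢ nil →
  (0ℚ < x * i) × (x * i < 1ℚ)
unit-interval {x} {y} {i} Di≡1 sx sy si σ≢nil = same-sgn⇒0<* sx si σ≢nil ,
  0<1-t⇒t<1 (subst (0ℚ <_) (sym 1-xi≡yi) (same-sgn⇒0<* sy si σ≢nil))
  where
  1-xi≡yi : 1ℚ - x * i ≡ y * i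
  1-xi≡yi = trans (cong (_- x * i) (sym Di≡1)) (solve 3 (λ x y i → (x :+ y) :* i :- x :* i := y :* i) refl x y i)

opposite⇒crosses : ∀ a b c d → orient c d a ≢ 0ℚ →
  sgn (orient c d b) ≡ -ˢ sgn (orient c d a) → sgn (orient a b d) ≡ -ˢ sgn (orient a b c) → Crosses a b c d
opposite⇒crosses a b c d o₁≢0 opp-ab opp-cd =
  o₁ * i , (- o₃) * i , proj₁ s-inside , proj₂ s-inside , proj₁ t-inside , proj₂ t-inside , meet
  where
  open ≡-Reasoning
  o₁ = orient c d a
  o₂ = orient c d b
  o₃ = orient a b c
  o₄ = orient a b d
  σ = sgn o₁
  D = o₁ - o₂
  D≡o₄-o₃ : D ≡ o₄ - o₃
  D≡o₄-o₃ = orient-balance a b c d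
  sgn-D : sgn D ≡ σ
  sgn-D = sgn-difference opp-ab
  sgn-o₄ : sgn o₄ ≡ σ
  sgn-o₄ = trans (sym (sgn-difference (-ˢ-opposite opp-cd))) (trans (cong sgn (sym D≡o₄-o₃)) sgn-D)
  sgn-−o₂ : sgn (- o₂) ≡ σ
  sgn-−o₂ = trans (sgn-neg o₂) (trans (cong -ˢ_ opp-ab) (-ˢ-involutive σ))
  sgn-−o₃ : sgn (- o₃) ≡ σ
  sgn-−o₃ = trans (sgn-neg o₃) (trans (cong -ˢ_ (-ˢ-opposite opp-cd)) (trans (-ˢ-involutive _) sgn-o₄))
  instance
    D≢0 : NonZero D
    D≢0 = ≢-nonZero (sgn-≡⇒≢0 sgn-D o₁≢0)
  i = 1/ D
  Di≡1 : D * i ≡ 1ℚ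
  Di≡1 = *-inverseʳ D
  sgn-i : sgn i ≡ σ
  sgn-i = trans (sgn-1/ D) sgn-D
  D-rearranged : ∀ {z} → z ≡ o₄ - o₃ → z * i ≡ 1ℚ
  D-rearranged z≡ = trans (cong (_* i) (trans z≡ (sym D≡o₄-o₃))) Di≡1
  s-inside = unit-interval Di≡1 refl sgn-−o₂ sgn-i (≢0⇒sgn≢nil o₁≢0)
  t-inside = unit-interval (D-rearranged (solve 2 (λ o₃ o₄ → (:- o₃) :+ o₄ := o₄ :- o₃) refl o₃ o₄))
               sgn-−o₃ sgn-o₄ sgn-i (≢0⇒sgn≢nil o₁≢0)
  meet : along a b (o₁ * i) ≡ along c d ((- o₃) * i)
  meet = begin
    along a b (o₁ * i)                      ≡⟨ along-as-combination a b o₁ o₂ i Di≡1 ⟩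
    i ·ᵥ (o₁ ·ᵥ b +ᵥ (- o₂) ·ᵥ a)           ≡⟨ cong (i ·ᵥ_) (intersection-identity a b c d) ⟩
    i ·ᵥ ((- o₃) ·ᵥ d +ᵥ (- (- o₄)) ·ᵥ c)   ≡⟨ sym (along-as-combination c d (- o₃) (- o₄) i
                                                  (D-rearranged (solve 2 (λ o₃ o₄ → (:- o₃) :- (:- o₄) := o₄ :- o₃) refl o₃ o₄))) ⟩
    along c d ((- o₃) * i)                  ∎

shared-endpoint : ∀ {n} {ψ : Drawing n} {a b c} → GeneralPosition ψ → a ≢ b → b ≢ c → a ≢ c →
  ¬ Crosses (ψ a) (ψ b) (ψ a) (ψ c)
shared-endpoint {ψ = ψ} {a} {b} {c} (_ , orient≢0) a≢b b≢c a≢c cr = orient≢0 a b c a≢b b≢c a≢c (sgn≡nil⇒≡0 (begin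
  sgn (orient (ψ a) (ψ b) (ψ c))     ≡⟨ crosses⇒opposite {ψ a} {ψ b} {ψ a} {ψ c} cr ⟩
  -ˢ sgn (orient (ψ a) (ψ b) (ψ a))  ≡⟨ cong (-ˢ_ ∘ sgn) (orient-repeat₂ (ψ a) (ψ b)) ⟩
  -ˢ sgn 0ℚ                          ≡⟨ cong -ˢ_ sgn-0 ⟩
  nil                                ∎))
  where open ≡-Reasoning

crossing-edges-disjoint : ∀ {n} {ψ : Drawing n} {a b c d} → GeneralPosition ψ → a ≢ b → c ≢ d →
  ¬ ((a ≡ c) × (b ≡ d)) → ¬ ((a ≡ d) × (b ≡ c)) → Crosses (ψ a) (ψ b) (ψ c) (ψ d) →
  (a ≢ c) × (a ≢ d) × (b ≢ c) × (b ≢ d)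
crossing-edges-disjoint {ψ = ψ} {a} {b} {c} {d} gp a≢b c≢d not-same not-reversed cr =
  (λ { refl → shared-endpoint gp a≢b (λ b≡d → not-same (refl , b≡d)) c≢d cr }) ,
  (λ { refl → shared-endpoint gp a≢b (λ b≡c → not-reversed (refl , b≡c)) (c≢d ∘ sym)
                (crosses-flipʳ {ψ a} {ψ b} {ψ c} {ψ a} cr) }) ,
  (λ { refl → shared-endpoint gp (a≢b ∘ sym) (λ a≡d → not-reversed (a≡d , refl)) c≢d
                (crosses-flipˡ {ψ a} {ψ b} {ψ b} {ψ d} cr) }) ,
  (λ { refl → shared-endpoint gp (a≢b ∘ sym) (λ a≡c → not-same (a≡c , refl)) (c≢d ∘ sym)
                (crosses-flipˡ {ψ a} {ψ b} {ψ b} {ψ c} (crosses-flipʳ {ψ a} {ψ b} {ψ c} {ψ b} cr)) })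

isPlus isNil isMinus : Sign → Bool
isPlus plus = true
isPlus _    = false
isNil nil = true
isNil _   = false
isMinus minus = true
isMinus _     = false

0<⇔isPlus : ∀ x → (0ℚ < x) ⇔ T (isPlus (sgn x))
0<⇔isPlus x = mk⇔ (λ 0<x → subst (T ∘ isPlus) (sym (sgn-complete plus 0<x)) tt) (from-sign (sgn x) (sgn-sound x))
  where
  from-sign : ∀ σ → HasSign x σ → T (isPlus σ) → 0ℚ < x
  from-sign plus 0<x _ = 0<x

≡0⇔isNil : ∀ x → (x ≡ 0ℚ) ⇔ T (isNil (sgn x))
≡0⇔isNil x = mk⇔ (λ x≡0 → subst (T ∘ isNil) (sym (sgn-complete nil x≡0)) tt) (from-sign (sgn x) (sgn-sound x))
  where
  from-sign : ∀ σ → HasSign x σ → T (isNil σ) → x ≡ 0ℚ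
  from-sign nil x≡0 _ = x≡0

module _ {a b} {A : Set a} {B : Set b} {x y : Bool} where

  ×⇔T∧ : A ⇔ T x → B ⇔ T y → (A × B) ⇔ T (x ∧ y)
  ×⇔T∧ A⇔ B⇔ = ⇔-sym T-∧ ⇔-∘ (A⇔ ×-⇔ B⇔)

  ⊎⇔T∨ : A ⇔ T x → B ⇔ T y → (A ⊎ B) ⇔ T (x ∨ y)
  ⊎⇔T∨ A⇔ B⇔ = ⇔-sym T-∨ ⇔-∘ (A⇔ ⊎-⇔ B⇔)

¬⇔Tnot : ∀ {a} {A : Set a} {x} → A ⇔ T x → (¬ A) ⇔ T (not x)
¬⇔Tnot {x = true}  A⇔ = mk⇔ (λ ¬A → ¬A (from A⇔ tt)) λ ()
¬⇔Tnot {x = false} A⇔ = mk⇔ (λ _ → tt) (λ _ → to A⇔)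

¬T⇒Tnot : ∀ {x} → ¬ T x → T (not x)
¬T⇒Tnot {x} = to (¬⇔Tnot {x = x} (mk⇔ id id))

lexSign : Sign → Sign → Sign
lexSign nil   τ = τ
lexSign plus  _ = plus
lexSign minus _ = minus

lexSign-* : ∀ σ a b → lexSign (σ *ˢ a) (σ *ˢ b) ≡ σ *ˢ lexSign a b
lexSign-* plus  a     b = refl
lexSign-* nil   a     b = refl
lexSign-* minus plus  b = refl
lexSign-* minus nil   b = refl
lexSign-* minus minus b = refl

-- plus on the open half-plane Upper, nil at the origin, minus on the opposite half-plane
halfSign : Pt → Sign
halfSign (x , y) = lexSign (sgn y) (sgn x)

up : Pt → Bool
up p = isPlus (halfSign p)

Upper⇔up : ∀ p → Upper p ⇔ T (up p)
Upper⇔up (x , y) = by-sign (sgn y) (sgn-sound y)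
  where
  by-sign : ∀ σ → HasSign y σ → Upper (x , y) ⇔ T (isPlus (lexSign σ (sgn x)))
  by-sign plus  0<y = mk⇔ (λ _ → tt) (λ _ → inj₁ 0<y)
  by-sign nil   y≡0 = mk⇔ [ (λ 0<y → ⊥-elim (<-irrefl (sym y≡0) 0<y)) , to (0<⇔isPlus x) ∘ proj₂ ]′
                          (λ h → inj₂ (y≡0 , from (0<⇔isPlus x) h))
  by-sign minus y<0 = mk⇔ [ (λ 0<y → <-asym 0<y y<0) , (λ (y≡0 , _) → <-irrefl y≡0 y<0) ]′ λ ()

halfSign-scale : ∀ c p → halfSign (c ·ᵥ p) ≡ sgn c *ˢ halfSign p
halfSign-scale c (x , y) = trans (cong₂ lexSign (sgn-* c y) (sgn-* c x)) (lexSign-* (sgn c) (sgn y) (sgn x))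

halfSign-neg : ∀ p → halfSign (neg p) ≡ -ˢ halfSign p
halfSign-neg (x , y) = trans (cong₂ lexSign (sgn-neg y) (sgn-neg x)) (lexSign-* minus (sgn y) (sgn x))

hemisphere : Bool → Sign
hemisphere true  = plus
hemisphere false = minus

hemisphere-up : ∀ p → p ≢ 0ᵥ → hemisphere (up p) ≡ halfSign p
hemisphere-up (x , y) p≢0 = by-signs (sgn y) (sgn x) refl refl
  where
  by-signs : ∀ σ τ → sgn y ≡ σ → sgn x ≡ τ → hemisphere (isPlus (lexSign σ τ)) ≡ lexSign σ τ
  by-signs plus  _     _  _  = refl
  by-signs minus _     _  _  = refl
  by-signs nil   plus  _  _  = refl
  by-signs nil   minus _  _  = refl
  by-signs nil   nil   ey ex = ⊥-elim (p≢0 (cong₂ _,_ (sgn≡nil⇒≡0 ex) (sgn≡nil⇒≡0 ey)))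

sgn≢minus⇒0≤ : ∀ {x} → sgn x ≢ minus → 0ℚ ≤ x
sgn≢minus⇒0≤ {x} ≢minus = by-sign (sgn x) (sgn-sound x) ≢minus
  where
  by-sign : ∀ σ → HasSign x σ → σ ≢ minus → 0ℚ ≤ x
  by-sign plus  0<x _ = <⇒≤ 0<x
  by-sign nil   x≡0 _ = ≤-reflexive (sym x≡0)
  by-sign minus _   m = ⊥-elim (m refl)

nonMinus-sum-zero : ∀ {x y z} → sgn x ≢ minus → sgn y ≢ minus → sgn z ≢ minus → x + y + z ≡ 0ℚ → sgn x ≡ nil
nonMinus-sum-zero {x} {y} {z} nx ny nz sum = by-sign (sgn x) refl nx
  where
  by-sign : ∀ σ → sgn x ≡ σ → σ ≢ minus → σ ≡ nil
  by-sign plus  e _ = ⊥-elim (<-irrefl (sym sum)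
    (+-mono-<-≤ (+-mono-<-≤ (sgn≡plus⇒pos e) (sgn≢minus⇒0≤ ny)) (sgn≢minus⇒0≤ nz)))
  by-sign nil   _ _ = refl
  by-sign minus _ m = ⊥-elim (m refl)

nonMinus-sum-zero₃ : ∀ {x y z} → sgn x ≢ minus → sgn y ≢ minus → sgn z ≢ minus → x + y + z ≡ 0ℚ →
  (sgn x ≡ nil) × (sgn y ≡ nil) × (sgn z ≡ nil)
nonMinus-sum-zero₃ {x} {y} {z} nx ny nz sum =
  nonMinus-sum-zero nx ny nz sum ,
  nonMinus-sum-zero ny nx nz (trans (solve 3 (λ x y z → y :+ x :+ z := x :+ y :+ z) refl x y z) sum) ,
  nonMinus-sum-zero nz ny nx (trans (solve 3 (λ x y z → z :+ y :+ x := x :+ y :+ z) refl x y z) sum)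

halfSigns-sum-zero : ∀ {A B C} → A +ᵥ B +ᵥ C ≡ 0ᵥ →
  halfSign A ≢ minus → halfSign B ≢ minus → halfSign C ≢ minus →
  (halfSign A ≡ nil) × (halfSign B ≡ nil) × (halfSign C ≡ nil)
halfSigns-sum-zero {ax , ay} {bx , by} {cx , cy} sum nA nB nC =
  cong₂ lexSign ay≡0 ax≡0 , cong₂ lexSign by≡0 bx≡0 , cong₂ lexSign cy≡0 cx≡0
  where
  lex-first : ∀ {σ τ} → lexSign σ τ ≢ minus → σ ≢ minus
  lex-first m refl = m refl
  on-axis : ∀ {σ τ} → σ ≡ nil → lexSign σ τ ≢ minus → τ ≢ minus
  on-axis refl m = m
  ys = nonMinus-sum-zero₃ (lex-first nA) (lex-first nB) (lex-first nC) (cong proj₂ sum)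
  ay≡0 = proj₁ ys
  by≡0 = proj₁ (proj₂ ys)
  cy≡0 = proj₂ (proj₂ ys)
  xs = nonMinus-sum-zero₃ (on-axis ay≡0 nA) (on-axis by≡0 nB) (on-axis cy≡0 nC) (cong proj₁ sum)
  ax≡0 = proj₁ xs
  bx≡0 = proj₁ (proj₂ xs)
  cx≡0 = proj₂ (proj₂ xs)

neg-sum-zero : ∀ {A B C} → A +ᵥ B +ᵥ C ≡ 0ᵥ → neg A +ᵥ neg B +ᵥ neg C ≡ 0ᵥ
neg-sum-zero {ax , ay} {bx , by} {cx , cy} sum =
  cong₂ _,_ (negated ax bx cx (cong proj₁ sum)) (negated ay by cy (cong proj₂ sum))
  where
  negated : ∀ a b c → a + b + c ≡ 0ℚ → - a + - b + - c ≡ 0ℚ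
  negated a b c s = trans (solve 3 (λ a b c → :- a :+ :- b :+ :- c := :- (a :+ b :+ c)) refl a b c) (cong -_ s)

plücker : ∀ r s r′ → cross r′ s ·ᵥ r +ᵥ cross r r′ ·ᵥ s +ᵥ cross s r ·ᵥ r′ ≡ 0ᵥ
plücker (a , b) (c , d) (e , f) = cong₂ _,_
  (solve 6 (λ a b c d e f → (e :* d :- f :* c) :* a :+ (a :* f :- b :* e) :* c :+ (c :* b :- d :* a) :* e := con 0ℚ)
    refl a b c d e f)
  (solve 6 (λ a b c d e f → (e :* d :- f :* c) :* b :+ (a :* f :- b :* e) :* d :+ (c :* b :- d :* a) :* f := con 0ℚ)
    refl a b c d e f)

oneSided : Sign → Sign → Sign → Bool
oneSided α β γ = (not (isMinus α) ∧ not (isMinus β) ∧ not (isMinus γ)) ∧ not (isNil α ∧ isNil β ∧ isNil γ)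

-- the half-plane signs of three vectors with zero sum are all nil, or include both plus and minus
consistent : Sign → Sign → Sign → Bool
consistent α β γ = not (oneSided α β γ) ∧ not (oneSided (-ˢ α) (-ˢ β) (-ˢ γ))

not-oneSided : ∀ {A B C} → A +ᵥ B +ᵥ C ≡ 0ᵥ → ¬ T (oneSided (halfSign A) (halfSign B) (halfSign C))
not-oneSided {A} {B} {C} sum h = subst (λ (α , β , γ) → T (not (isNil α ∧ isNil β ∧ isNil γ))) all-nil (proj₂ parts)
  where
  α = halfSign A
  β = halfSign B
  γ = halfSign C
  non-minus : ∀ {σ} → T (not (isMinus σ)) → σ ≢ minus
  non-minus h refl = h
  parts = to (T-∧ {not (isMinus α) ∧ not (isMinus β) ∧ not (isMinus γ)} {not (isNil α ∧ isNil β ∧ isNil γ)}) h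
  nA,nBC = to (T-∧ {not (isMinus α)} {not (isMinus β) ∧ not (isMinus γ)}) (proj₁ parts)
  nB,nC = to (T-∧ {not (isMinus β)} {not (isMinus γ)}) (proj₂ nA,nBC)
  nils = halfSigns-sum-zero sum (non-minus (proj₁ nA,nBC)) (non-minus (proj₁ nB,nC)) (non-minus (proj₂ nB,nC))
  all-nil : (α , β , γ) ≡ (nil , nil , nil)
  all-nil = cong₂ _,_ (proj₁ nils) (cong₂ _,_ (proj₁ (proj₂ nils)) (proj₂ (proj₂ nils)))

zero-sum-consistent : ∀ {A B C} → A +ᵥ B +ᵥ C ≡ 0ᵥ → T (consistent (halfSign A) (halfSign B) (halfSign C))
zero-sum-consistent {A} {B} {C} sum =
  from (T-∧ {not (oneSided α β γ)} {not (oneSided (-ˢ α) (-ˢ β) (-ˢ γ))})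
    (¬T⇒Tnot (not-oneSided sum) , ¬T⇒Tnot negated)
  where
  α = halfSign A
  β = halfSign B
  γ = halfSign C
  negated : ¬ T (oneSided (-ˢ α) (-ˢ β) (-ˢ γ))
  negated = subst (λ (α′ , β′ , γ′) → ¬ T (oneSided α′ β′ γ′))
              (cong₂ _,_ (halfSign-neg A) (cong₂ _,_ (halfSign-neg B) (halfSign-neg C)))
              (not-oneSided (neg-sum-zero {A} {B} {C} sum))

angLtᵇ : Bool → Bool → Sign → Bool
angLtᵇ ha hb σ = (ha ∧ not hb) ∨ (((ha ∧ hb) ∨ (not ha ∧ not hb)) ∧ isPlus σ)

AngLt⇔ : ∀ a b → AngLt a b ⇔ T (angLtᵇ (up a) (up b) (sgn (cross a b)))
AngLt⇔ a b = ⊎⇔T∨ (×⇔T∧ Ua (¬⇔Tnot Ub))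
                   (×⇔T∧ (⊎⇔T∨ (×⇔T∧ Ua Ub) (×⇔T∧ (¬⇔Tnot Ua) (¬⇔Tnot Ub))) (0<⇔isPlus (cross a b)))
  where
  Ua = Upper⇔up a
  Ub = Upper⇔up b

cwBetweenᵇ : Bool → Bool → Bool → Sign → Sign → Sign → Bool
cwBetweenᵇ hr hs hr′ p q t =
  (angLtᵇ hs hr p ∧ angLtᵇ hr′ hs q) ∨ (angLtᵇ hr′ hs q ∧ angLtᵇ hr hr′ t) ∨ (angLtᵇ hr hr′ t ∧ angLtᵇ hs hr p)

CwBetween⇔ : ∀ r s r′ → CwBetween r s r′ ⇔
  T (cwBetweenᵇ (up r) (up s) (up r′) (sgn (cross s r)) (sgn (cross r′ s)) (sgn (cross r r′)))
CwBetween⇔ r s r′ = ⊎⇔T∨ (×⇔T∧ s<r r′<s) (⊎⇔T∨ (×⇔T∧ r′<s r<r′) (×⇔T∧ r<r′ s<r))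
  where
  s<r = AngLt⇔ s r
  r′<s = AngLt⇔ r′ s
  r<r′ = AngLt⇔ r r′

-- With p, q, t the signs of cross s r, cross r′ s, cross r r′: s is less than a half-turn clockwise from r
-- iff p = plus, less than a half-turn anticlockwise from r′ iff q = plus, and the clockwise arc from r to
-- r′ is shorter than a half-turn iff t = minus.
cwSigns : Sign → Sign → Sign → Bool
cwSigns p q t = (isMinus t ∧ isPlus q ∧ isPlus p) ∨ (isPlus t ∧ (isPlus q ∨ isPlus p))

allBools : (Bool → Bool) → Bool
allBools f = f true ∧ f false

allSigns : (Sign → Bool) → Bool
allSigns f = f plus ∧ f nil ∧ f minus

allBools-sound : ∀ f → T (allBools f) → ∀ b → T (f b)
allBools-sound f h true  = proj₁ (to (T-∧ {f true}) h)
allBools-sound f h false = proj₂ (to (T-∧ {f true}) h)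

allSigns-sound : ∀ f → T (allSigns f) → ∀ σ → T (f σ)
allSigns-sound f h plus  = proj₁ (to (T-∧ {f plus}) h)
allSigns-sound f h nil   = proj₁ (to (T-∧ {f nil}) (proj₂ (to (T-∧ {f plus}) h)))
allSigns-sound f h minus = proj₂ (to (T-∧ {f nil}) (proj₂ (to (T-∧ {f plus}) h)))

cw-table-entry : Bool → Bool → Bool → Sign → Sign → Sign → Bool
cw-table-entry hr hs hr′ p q t =
  not (not (isNil t) ∧ consistent (q *ˢ hemisphere hr) (t *ˢ hemisphere hs) (p *ˢ hemisphere hr′))
  ∨ ⌊ cwBetweenᵇ hr hs hr′ p q t Bool.≟ cwSigns p q t ⌋

-- all 216 entries, checked by evaluation
cw-table-entries : T (allBools λ hr → allBools λ hs → allBools λ hr′ →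
                      allSigns λ p → allSigns λ q → allSigns (cw-table-entry hr hs hr′ p q))
cw-table-entries = _

cw-table : ∀ hr hs hr′ p q t → T (not (isNil t)) →
  T (consistent (q *ˢ hemisphere hr) (t *ˢ hemisphere hs) (p *ˢ hemisphere hr′)) →
  cwBetweenᵇ hr hs hr′ p q t ≡ cwSigns p q t
cw-table hr hs hr′ p q t t≢nil cons with to T-∨ entry
  where
  entry : T (cw-table-entry hr hs hr′ p q t)
  entry =
    allSigns-sound (cw-table-entry hr hs hr′ p q) (allSigns-sound (λ q → allSigns (cw-table-entry hr hs hr′ p q))
    (allSigns-sound (λ p → allSigns λ q → allSigns (cw-table-entry hr hs hr′ p q))
    (allBools-sound (λ hr′ → allSigns λ p → allSigns λ q → allSigns (cw-table-entry hr hs hr′ p q))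
    (allBools-sound (λ hs → allBools λ hr′ → allSigns λ p → allSigns λ q → allSigns (cw-table-entry hr hs hr′ p q))
    (allBools-sound (λ hr → allBools λ hs → allBools λ hr′ → allSigns λ p → allSigns λ q →
                      allSigns (cw-table-entry hr hs hr′ p q))
      cw-table-entries hr) hs) hr′) p) q) t
... | inj₁ excluded = ⊥-elim (contradiction excluded (from T-∧ (t≢nil , cons)))
  where
  contradiction : ∀ {x} → T (not x) → T x → ⊥
  contradiction {true} ()
... | inj₂ agree = toWitness agree

cwBetween⇔signs : ∀ {r s r′} → r ≢ 0ᵥ → s ≢ 0ᵥ → r′ ≢ 0ᵥ → cross r r′ ≢ 0ℚ →
  CwBetween r s r′ ⇔ T (cwSigns (sgn (cross s r)) (sgn (cross r′ s)) (sgn (cross r r′)))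
cwBetween⇔signs {r} {s} {r′} r≢0 s≢0 r′≢0 rr′≢0 =
  subst (λ b → CwBetween r s r′ ⇔ T b) (cw-table (up r) (up s) (up r′) p q t t≢nil consistency) (CwBetween⇔ r s r′)
  where
  p = sgn (cross s r)
  q = sgn (cross r′ s)
  t = sgn (cross r r′)
  t≢nil : T (not (isNil t))
  t≢nil = ¬T⇒Tnot (rr′≢0 ∘ from (≡0⇔isNil (cross r r′)))
  scaled : ∀ c v → v ≢ 0ᵥ → halfSign (c ·ᵥ v) ≡ sgn c *ˢ hemisphere (up v)
  scaled c v v≢0 = trans (halfSign-scale c v) (cong (sgn c *ˢ_) (sym (hemisphere-up v v≢0)))
  consistency : T (consistent (q *ˢ hemisphere (up r)) (t *ˢ hemisphere (up s)) (p *ˢ hemisphere (up r′)))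
  consistency = subst (λ (α , β , γ) → T (consistent α β γ))
    (cong₂ _,_ (scaled (cross r′ s) r r≢0) (cong₂ _,_ (scaled (cross r r′) s s≢0) (scaled (cross s r) r′ r′≢0)))
    (zero-sum-consistent {cross r′ s ·ᵥ r} {cross r r′ ·ᵥ s} {cross s r ·ᵥ r′} (plücker r s r′))

cwBetween-transport : ∀ {r s r′ R S R′} → r ≢ 0ᵥ → s ≢ 0ᵥ → r′ ≢ 0ᵥ → R ≢ 0ᵥ → S ≢ 0ᵥ → R′ ≢ 0ᵥ →
  cross r r′ ≢ 0ℚ → sgn (cross s r) ≡ sgn (cross S R) → sgn (cross r′ s) ≡ sgn (cross R′ S) →
  sgn (cross r r′) ≡ sgn (cross R R′) → CwBetween r s r′ → CwBetween R S R′
cwBetween-transport {r} {s} {r′} {R} {S} {R′} r≢0 s≢0 r′≢0 R≢0 S≢0 R′≢0 rr′≢0 e₁ e₂ e₃ cw =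
  from (cwBetween⇔signs R≢0 S≢0 R′≢0 RR′≢0)
    (subst₂ (λ p q → T (cwSigns p q (sgn (cross R R′)))) e₁ e₂
      (subst (T ∘ cwSigns (sgn (cross s r)) (sgn (cross r′ s))) e₃ (to (cwBetween⇔signs r≢0 s≢0 r′≢0 rr′≢0) cw)))
  where
  RR′≢0 : cross R R′ ≢ 0ℚ
  RR′≢0 RR′≡0 = ≢0⇒sgn≢nil rr′≢0 (trans e₃ (trans (cong sgn RR′≡0) sgn-0))

same-side-of-avoided-line : ∀ {A B x} → A ≢ 0ᵥ → B ≢ 0ᵥ → x ≢ 0ᵥ → cross A B ≢ 0ℚ → cross x A ≢ 0ℚ → cross x B ≢ 0ℚ →
  ¬ CwBetween A x B → ¬ CwBetween A (neg x) B → sgn (cross x B) ≡ sgn (cross x A)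
same-side-of-avoided-line {A} {B} {x} A≢0 B≢0 x≢0 AB≢0 xA≢0 xB≢0 ¬cw ¬cw′ = begin
  sgn (cross x B)        ≡⟨ cong sgn (cross-antisym B x) ⟩
  sgn (- cross B x)      ≡⟨ sgn-neg (cross B x) ⟩
  -ˢ sgn (cross B x)     ≡⟨ cong -ˢ_ (opposite (sgn (cross x A)) (sgn (cross B x)) (sgn (cross A B))
                              (≢0⇒sgn≢nil xA≢0) Bx≢nil (≢0⇒sgn≢nil AB≢0) ¬signs ¬signs′) ⟩
  -ˢ (-ˢ sgn (cross x A)) ≡⟨ -ˢ-involutive _ ⟩
  sgn (cross x A)        ∎
  where
  open ≡-Reasoning
  Bx≢nil : sgn (cross B x) ≢ nil
  Bx≢nil = ≢0⇒sgn≢nil (λ Bx≡0 → xB≢0 (trans (cross-antisym B x) (cong -_ Bx≡0)))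
  ¬signs : ¬ T (cwSigns (sgn (cross x A)) (sgn (cross B x)) (sgn (cross A B)))
  ¬signs = ¬cw ∘ from (cwBetween⇔signs A≢0 x≢0 B≢0 AB≢0)
  ¬signs′ : ¬ T (cwSigns (-ˢ sgn (cross x A)) (-ˢ sgn (cross B x)) (sgn (cross A B)))
  ¬signs′ = ¬cw′ ∘ from (cwBetween⇔signs A≢0 (x≢0 ∘ neg≡0ᵥ) B≢0 AB≢0)
          ∘ subst₂ (λ p q → T (cwSigns p q (sgn (cross A B))))
              (trans (sym (sgn-neg _)) (cong sgn (sym (cross-negˡ x A))))
              (trans (sym (sgn-neg _)) (cong sgn (sym (cross-negʳ B x))))
  opposite : ∀ p q t → p ≢ nil → q ≢ nil → t ≢ nil →
    ¬ T (cwSigns p q t) → ¬ T (cwSigns (-ˢ p) (-ˢ q) t) → q ≡ -ˢ p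
  opposite plus  minus _     _ _ _ _  _   = refl
  opposite minus plus  _     _ _ _ _  _   = refl
  opposite plus  plus  plus  _ _ _ ¬cw _   = ⊥-elim (¬cw tt)
  opposite plus  plus  minus _ _ _ ¬cw _   = ⊥-elim (¬cw tt)
  opposite minus minus plus  _ _ _ _  ¬cw′ = ⊥-elim (¬cw′ tt)
  opposite minus minus minus _ _ _ _  ¬cw′ = ⊥-elim (¬cw′ tt)
  opposite nil   _     _     p≢nil _ _ _ _ = ⊥-elim (p≢nil refl)
  opposite _     nil   _     _ q≢nil _ _ _ = ⊥-elim (q≢nil refl)
  opposite _     _     nil   _ _ t≢nil _ _ = ⊥-elim (t≢nil refl)

Edge⇒≢ : ∀ {n} (G : Graph n) {a b} → Edge G a b → a ≢ b
Edge⇒≢ G {a} e refl = subst T (irr G a) e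

Edge-sym : ∀ {n} (G : Graph n) {a b} → Edge G a b → Edge G b a
Edge-sym G {a} {b} = subst T (symm G a b)

sum-allFin-suc : ∀ {n} (f : Fin (ℕ.suc n) → ℕ) → sum (map f (allFin (ℕ.suc n))) ≡ f zero ℕ.+ sum (map (f ∘ suc) (allFin n))
sum-allFin-suc f = cong (λ xs → f zero ℕ.+ sum xs) (trans (map-tabulate suc f) (sym (map-tabulate id (f ∘ suc))))

degree-addOnto-new : ∀ {n} (G : Graph n) v → degree (addOnto G v) zero ≡ degree G v
degree-addOnto-new G v = sum-allFin-suc (λ u → if adj (addOnto G v) zero u then 1 else 0)

degree-addOnto-old : ∀ {n} (G : Graph n) v y →
  degree (addOnto G v) (suc y) ≡ (if adj G v y then 1 else 0) ℕ.+ degree G y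
degree-addOnto-old G v y = sum-allFin-suc (λ u → if adj (addOnto G v) (suc y) u then 1 else 0)

1≢m+m : ∀ m → 1 ≢ m ℕ.+ m
1≢m+m ℕ.zero    ()
1≢m+m (ℕ.suc m) e = ℕₚ.0≢1+n (trans (ℕₚ.suc-injective e) (ℕₚ.+-suc m m))

CyclicSuccessor : (m : ℕ) → Fin m → Fin m → Set
CyclicSuccessor m p q = (toℕ q ≡ ℕ.suc (toℕ p)) ⊎ ((toℕ q ≡ 0) × (ℕ.suc (toℕ p) ≡ m))

cyclic-successor≢ : ∀ {m} {p q : Fin (m ℕ.+ m)} → CyclicSuccessor (m ℕ.+ m) p q → p ≢ q
cyclic-successor≢ (inj₁ q≡1+p)          refl = ℕₚ.1+n≢n (sym q≡1+p)
cyclic-successor≢ {m} (inj₂ (q≡0 , 1+p≡2m)) refl = 1≢m+m m (trans (cong ℕ.suc (sym q≡0)) 1+p≡2m)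

↑ˡ≢↑ʳ : ∀ {k} (i j : Fin k) → i ↑ˡ k ≢ k ↑ʳ j
↑ˡ≢↑ʳ {k} i j e with trans (sym (splitAt-↑ˡ k i k)) (trans (cong (splitAt k) e) (splitAt-↑ʳ k k j))
... | ()

module Insertion {k n : ℕ} (G : Graph n) (φ : Drawing n) (col : Colouring n k) (good : Good k G φ col)
                 (v : Fin n) (fan : Fan G φ v k col) (j₀ : Fin k) where

  φ-injective : ∀ a b → φ a ≡ φ b → a ≡ b
  φ-injective = proj₁ (proj₁ good)

  orient≢0 : ∀ a b c → a ≢ b → b ≢ c → a ≢ c → orient (φ a) (φ b) (φ c) ≢ 0ℚ
  orient≢0 = proj₂ (proj₁ good)

  colour-sym : ∀ a b → Edge G a b → col a b ≡ col b a
  colour-sym = proj₁ (proj₁ (proj₂ good))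

  non-crossing : ∀ a b c d → Edge G a b → Edge G c d → ¬ ((a ≡ c) × (b ≡ d)) → ¬ ((a ≡ d) × (b ≡ c)) →
    col a b ≡ col c d → ¬ Crosses (φ a) (φ b) (φ c) (φ d)
  non-crossing = proj₂ (proj₁ (proj₂ good))

  L : Fin (k ℕ.+ k) → Fin n
  L = proj₁ (proj₂ fan)

  L-clockwise : ClockwiseLabelling G φ v (k ℕ.+ k) L
  L-clockwise = proj₁ (proj₂ (proj₂ fan))

  L-injective : ∀ p q → L p ≡ L q → p ≡ q
  L-injective = proj₁ L-clockwise

  L-edge : ∀ p → Edge G v (L p)
  L-edge = proj₁ (proj₂ L-clockwise)

  L-onto : ∀ u → Edge G v u → Σ (Fin (k ℕ.+ k)) λ p → L p ≡ u
  L-onto = proj₁ (proj₂ (proj₂ L-clockwise))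

  L-balanced : Balanced G φ v k L
  L-balanced = proj₁ (proj₂ (proj₂ (proj₂ fan)))

  u⁺ u⁻ : Fin k → Fin n
  u⁺ = uPos G φ v k L
  u⁻ = uNeg G φ v k L

  col-u⁺ : ∀ j → col v (u⁺ j) ≡ j
  col-u⁺ j = proj₁ (proj₂ (proj₂ (proj₂ (proj₂ fan))) j)

  col-u⁻ : ∀ j → col v (u⁻ j) ≡ j
  col-u⁻ j = proj₂ (proj₂ (proj₂ (proj₂ (proj₂ fan))) j)

  neighbour≢v : ∀ {x} → Edge G v x → x ≢ v
  neighbour≢v e = Edge⇒≢ G e ∘ sym

  u⁺≢v : ∀ j → u⁺ j ≢ v
  u⁺≢v j = neighbour≢v (L-edge (j ↑ˡ k))

  u⁻≢v : ∀ j → u⁻ j ≢ v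
  u⁻≢v j = neighbour≢v (L-edge (k ↑ʳ j))

  u⁺≢u⁻ : ∀ i j → u⁺ i ≢ u⁻ j
  u⁺≢u⁻ i j = ↑ˡ≢↑ʳ i j ∘ L-injective _ _

  u⁺-injective : ∀ i j → u⁺ i ≡ u⁺ j → i ≡ j
  u⁺-injective i j = ↑ˡ-injective k i j ∘ L-injective _ _

  neighbour-labels : ∀ {x} → Edge G v x → ∃ λ j → (x ≡ u⁺ j) ⊎ (x ≡ u⁻ j)
  neighbour-labels {x} e with L-onto x e
  ... | p , Lp≡x = by-half (splitAt k p) (join-splitAt k k p)
    where
    by-half : ∀ h → join k k h ≡ p → ∃ λ j → (x ≡ u⁺ j) ⊎ (x ≡ u⁻ j)
    by-half (inj₁ j) h = j , inj₁ (trans (sym Lp≡x) (cong L (sym h)))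
    by-half (inj₂ j) h = j , inj₂ (trans (sym Lp≡x) (cong L (sym h)))

  ray : Pt → Fin n → Bool → Pt
  ray c x b = signed b (vec c (φ x))

  V : Pt
  V = φ v

  δ : Fin n → Pt
  δ x = vec V (φ x)

  δ≢0ᵥ : ∀ {x} → x ≢ v → δ x ≢ 0ᵥ
  δ≢0ᵥ x≢v = x≢v ∘ φ-injective _ _ ∘ vec≡0ᵥ

  cross-δ≢0 : ∀ {x y} → x ≢ v → y ≢ v → x ≢ y → cross (δ x) (δ y) ≢ 0ℚ
  cross-δ≢0 x≢v y≢v x≢y = orient≢0 _ _ _ (x≢v ∘ sym) x≢y (y≢v ∘ sym)

  cross-ray-V≢0 : ∀ {x y} b b′ → x ≢ v → y ≢ v → x ≢ y → cross (ray V x b) (ray V y b′) ≢ 0ℚ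
  cross-ray-V≢0 b b′ x≢v y≢v x≢y = cross-signed≢0 b b′ (cross-δ≢0 x≢v y≢v x≢y)

  ray-in-R : ∀ {x} → Edge G v x → ∀ b → InR G φ v (ray V x b)
  ray-in-R {x} e false = x , e , inj₁ refl
  ray-in-R {x} e true  = x , e , inj₂ refl

  a₁ b₁ : Pt
  a₁ = δ (u⁺ j₀)
  b₁ = δ (u⁻ j₀)

  consecutive⇒same-side-of-a₁ : ∀ {x y} b b′ → x ≢ v → y ≢ v → x ≢ y → u⁺ j₀ ≢ x → u⁺ j₀ ≢ y →
    ConsecutiveR G φ v (ray V x b) (ray V y b′) → sgn (cross a₁ (ray V y b′)) ≡ sgn (cross a₁ (ray V x b))
  consecutive⇒same-side-of-a₁ b b′ x≢v y≢v x≢y u₁≢x u₁≢y (inj₁ no-ray) =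
    same-side-of-avoided-line (signed≢0ᵥ b (δ≢0ᵥ x≢v)) (signed≢0ᵥ b′ (δ≢0ᵥ y≢v)) (δ≢0ᵥ (u⁺≢v j₀))
      (cross-ray-V≢0 b b′ x≢v y≢v x≢y) (cross-ray-V≢0 false b (u⁺≢v j₀) x≢v u₁≢x)
      (cross-ray-V≢0 false b′ (u⁺≢v j₀) y≢v u₁≢y)
      (no-ray a₁ (ray-in-R (L-edge (j₀ ↑ˡ k)) false)) (no-ray (neg a₁) (ray-in-R (L-edge (j₀ ↑ˡ k)) true))
  consecutive⇒same-side-of-a₁ b b′ x≢v y≢v x≢y u₁≢x u₁≢y (inj₂ no-ray) = sym
    (same-side-of-avoided-line (signed≢0ᵥ b′ (δ≢0ᵥ y≢v)) (signed≢0ᵥ b (δ≢0ᵥ x≢v)) (δ≢0ᵥ (u⁺≢v j₀))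
      (cross-ray-V≢0 b′ b y≢v x≢v (x≢y ∘ sym)) (cross-ray-V≢0 false b′ (u⁺≢v j₀) y≢v u₁≢y)
      (cross-ray-V≢0 false b (u⁺≢v j₀) x≢v u₁≢x)
      (no-ray a₁ (ray-in-R (L-edge (j₀ ↑ˡ k)) false)) (no-ray (neg a₁) (ray-in-R (L-edge (j₀ ↑ˡ k)) true)))

  a₁-separates-pairs : ∀ j → j ≢ j₀ → sgn (cross a₁ (δ (u⁻ j))) ≡ -ˢ sgn (cross a₁ (δ (u⁺ j)))
  a₁-separates-pairs j j≢j₀ = -ˢ-opposite (sym (trans (sym (sgn-cross-signed false true a₁ (δ (u⁻ j))))
    (consecutive⇒same-side-of-a₁ false true (u⁺≢v j) (u⁻≢v j) (u⁺≢u⁻ j j)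
      (j≢j₀ ∘ sym ∘ u⁺-injective j₀ j) (u⁺≢u⁻ j₀ j) (proj₁ (L-balanced j)))))

  -- d is a₁ turned slightly towards b₁: it sees every other δ x on the same side as a₁ does,
  -- and now also separates u⁺ j₀ from u⁻ j₀
  private
    η-choice = small-perturbation (λ x → cross a₁ (δ x)) (λ x → cross b₁ (δ x))

  η : ℚ
  η = proj₁ η-choice

  0<η : 0ℚ < η
  0<η = proj₁ (proj₂ η-choice)

  d : Pt
  d = a₁ +ᵥ η ·ᵥ b₁

  sgn-cross-d : ∀ {x} → x ≢ v → x ≢ u⁺ j₀ → sgn (cross d (δ x)) ≡ sgn (cross a₁ (δ x))
  sgn-cross-d {x} x≢v x≢u₁ = trans (cong sgn (cross-linearˡ a₁ η b₁ (δ x)))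
    (proj₂ (proj₂ η-choice) x (cross-δ≢0 (u⁺≢v j₀) x≢v (x≢u₁ ∘ sym)))

  sgn-cross-d-a₁ : sgn (cross d a₁) ≡ sgn (cross b₁ a₁)
  sgn-cross-d-a₁ = begin
    sgn (cross d a₁)                       ≡⟨ cong sgn (cross-linearˡ a₁ η b₁ a₁) ⟩
    sgn (cross a₁ a₁ + η * cross b₁ a₁)    ≡⟨ cong (λ z → sgn (z + η * cross b₁ a₁)) (cross-self a₁) ⟩
    sgn (0ℚ + η * cross b₁ a₁)             ≡⟨ cong sgn (+-identityˡ _) ⟩
    sgn (η * cross b₁ a₁)                  ≡⟨ sgn-*-pos (cross b₁ a₁) 0<η ⟩
    sgn (cross b₁ a₁)                      ∎
    where open ≡-Reasoning

  sgn-cross-d-b₁ : sgn (cross d b₁) ≡ -ˢ sgn (cross b₁ a₁)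
  sgn-cross-d-b₁ = begin
    sgn (cross d b₁)                       ≡⟨ cong sgn (cross-linearˡ a₁ η b₁ b₁) ⟩
    sgn (cross a₁ b₁ + η * cross b₁ b₁)    ≡⟨ cong (λ z → sgn (cross a₁ b₁ + η * z)) (cross-self b₁) ⟩
    sgn (cross a₁ b₁ + η * 0ℚ)             ≡⟨ cong (λ z → sgn (cross a₁ b₁ + z)) (*-zeroʳ η) ⟩
    sgn (cross a₁ b₁ + 0ℚ)                 ≡⟨ cong sgn (+-identityʳ _) ⟩
    sgn (cross a₁ b₁)                      ≡⟨ cong sgn (cross-antisym b₁ a₁) ⟩
    sgn (- cross b₁ a₁)                    ≡⟨ sgn-neg _ ⟩
    -ˢ sgn (cross b₁ a₁)                   ∎
    where open ≡-Reasoning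

  d-separates-pairs : ∀ j → sgn (cross d (δ (u⁻ j))) ≡ -ˢ sgn (cross d (δ (u⁺ j)))
  d-separates-pairs j with j Finₚ.≟ j₀
  ... | yes refl = trans sgn-cross-d-b₁ (cong -ˢ_ (sym sgn-cross-d-a₁))
  ... | no j≢j₀ = begin
    sgn (cross d (δ (u⁻ j)))        ≡⟨ sgn-cross-d (u⁻≢v j) (u⁺≢u⁻ j₀ j ∘ sym) ⟩
    sgn (cross a₁ (δ (u⁻ j)))       ≡⟨ a₁-separates-pairs j j≢j₀ ⟩
    -ˢ sgn (cross a₁ (δ (u⁺ j)))    ≡⟨ cong -ˢ_ (sym (sgn-cross-d (u⁺≢v j) (j≢j₀ ∘ u⁺-injective j j₀))) ⟩
    -ˢ sgn (cross d (δ (u⁺ j)))     ∎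
    where open ≡-Reasoning

  cross-d≢0 : ∀ {x} → x ≢ v → cross d (δ x) ≢ 0ℚ
  cross-d≢0 {x} x≢v with x Finₚ.≟ u⁺ j₀
  ... | yes refl = sgn-≡⇒≢0 sgn-cross-d-a₁ (cross-δ≢0 (u⁻≢v j₀) (u⁺≢v j₀) (u⁺≢u⁻ j₀ j₀ ∘ sym))
  ... | no x≢u₁ = sgn-≡⇒≢0 (sgn-cross-d x≢v x≢u₁) (cross-δ≢0 (u⁺≢v j₀) x≢v (x≢u₁ ∘ sym))

  private
    ε-choice = small-perturbation₂ (λ x y → orient V (φ x) (φ y)) (λ x y → - cross d (vec (φ x) (φ y)))

  ε : ℚ
  ε = proj₁ ε-choice

  0<ε : 0ℚ < ε
  0<ε = proj₁ (proj₂ ε-choice)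

  W : Pt
  W = V +ᵥ ε ·ᵥ d

  sgn-orient-W : ∀ {x y} → x ≢ v → y ≢ v → sgn (orient W (φ x) (φ y)) ≡ sgn (orient V (φ x) (φ y))
  sgn-orient-W {x} {y} x≢v y≢v with x Finₚ.≟ y
  ... | yes refl = cong sgn (trans (orient-repeat W (φ x)) (sym (orient-repeat V (φ x))))
  ... | no x≢y = trans (cong sgn (orient-displace V ε d (φ x) (φ y)))
                   (proj₂ (proj₂ ε-choice) x y (orient≢0 v x y (x≢v ∘ sym) x≢y (y≢v ∘ sym)))

  sgn-orient-W-V : ∀ x → sgn (orient W (φ x) V) ≡ sgn (cross d (δ x))
  sgn-orient-W-V x = trans (cong sgn (orient-displace-from V ε d (φ x))) (sgn-*-pos _ 0<ε)

  orient-W≢0 : ∀ {x y} → x ≢ y → orient W (φ x) (φ y) ≢ 0ℚ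
  orient-W≢0 {x} {y} x≢y with x Finₚ.≟ v | y Finₚ.≟ v
  ... | yes refl | _      = λ e → orient-W-y-V≢0 (neg-injective (trans (sym (orient-swap W (φ y) V)) e))
    where orient-W-y-V≢0 = sgn-≡⇒≢0 (sgn-orient-W-V y) (cross-d≢0 (x≢y ∘ sym))
  ... | no x≢v  | yes refl = sgn-≡⇒≢0 (sgn-orient-W-V x) (cross-d≢0 x≢v)
  ... | no x≢v  | no y≢v  = sgn-≡⇒≢0 (sgn-orient-W x≢v y≢v) (orient≢0 v x y (x≢v ∘ sym) x≢y (y≢v ∘ sym))

  W≢φ : ∀ x → W ≢ φ x
  W≢φ x W≡φx with x Finₚ.≟ v
  ... | yes refl = orient-W≢0 (u⁺≢v j₀)
                     (trans (cong (λ p → orient p (φ (u⁺ j₀)) V) W≡φx) (orient-repeat₂ V (φ (u⁺ j₀))))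
  ... | no x≢v  = orient-W≢0 x≢v (trans (cong (λ p → orient p (φ x) V) W≡φx) (orient-repeat₁ (φ x) V))

  φ′ : Drawing (ℕ.suc n)
  φ′ zero    = W
  φ′ (suc i) = φ i

  general-position′ : GeneralPosition φ′
  general-position′ = injective′ , orient′≢0
    where
    injective′ : ∀ a b → φ′ a ≡ φ′ b → a ≡ b
    injective′ zero    zero    _ = refl
    injective′ zero    (suc b) e = ⊥-elim (W≢φ b e)
    injective′ (suc a) zero    e = ⊥-elim (W≢φ a (sym e))
    injective′ (suc a) (suc b) e = cong suc (φ-injective a b e)
    orient′≢0 : ∀ a b c → a ≢ b → b ≢ c → a ≢ c → orient (φ′ a) (φ′ b) (φ′ c) ≢ 0ℚ
    orient′≢0 zero    zero    _       a≢b _   _   = ⊥-elim (a≢b refl)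
    orient′≢0 zero    (suc b) zero    _   _   a≢c = ⊥-elim (a≢c refl)
    orient′≢0 (suc a) zero    zero    _   b≢c _   = ⊥-elim (b≢c refl)
    orient′≢0 zero    (suc b) (suc c) _   b≢c _   = orient-W≢0 (b≢c ∘ cong suc)
    orient′≢0 (suc a) zero    (suc c) _   _   a≢c =
      orient-W≢0 (a≢c ∘ cong suc ∘ sym) ∘ trans (sym (orient-rotate (φ a) W (φ c)))
    orient′≢0 (suc a) (suc b) zero    a≢b _   _   =
      orient-W≢0 (a≢b ∘ cong suc) ∘ trans (sym (trans (orient-rotate (φ a) (φ b) W) (orient-rotate (φ b) W (φ a))))
    orient′≢0 (suc a) (suc b) (suc c) a≢b b≢c a≢c =
      orient≢0 a b c (a≢b ∘ cong suc) (b≢c ∘ cong suc) (a≢c ∘ cong suc)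

  G′ : Graph (ℕ.suc n)
  G′ = addOnto G v

  col′ : Colouring (ℕ.suc n) k
  col′ zero    zero    = col v v   -- ww is not an edge
  col′ zero    (suc j) = col v j
  col′ (suc i) zero    = col v i
  col′ (suc i) (suc j) = col i j

  partners-separated : ∀ {b y i} → b ≢ y → (b ≡ u⁺ i) ⊎ (b ≡ u⁻ i) → (y ≡ u⁺ i) ⊎ (y ≡ u⁻ i) →
    sgn (cross d (δ y)) ≡ -ˢ sgn (cross d (δ b))
  partners-separated b≢y (inj₁ refl) (inj₁ refl) = ⊥-elim (b≢y refl)
  partners-separated {i = i} _ (inj₁ refl) (inj₂ refl) = d-separates-pairs i
  partners-separated {i = i} _ (inj₂ refl) (inj₁ refl) = -ˢ-opposite (d-separates-pairs i)
  partners-separated b≢y (inj₂ refl) (inj₂ refl) = ⊥-elim (b≢y refl)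

  same-colour-neighbours-separated : ∀ {b y} → Edge G v b → Edge G v y → b ≢ y → col v b ≡ col v y →
    sgn (cross d (δ y)) ≡ -ˢ sgn (cross d (δ b))
  same-colour-neighbours-separated {b} {y} eb ey b≢y same with neighbour-labels eb | neighbour-labels ey
  ... | i , b-label | j , y-label = partners-separated b≢y b-label (subst (λ l → (y ≡ u⁺ l) ⊎ (y ≡ u⁻ l)) (sym i≡j) y-label)
    where
    label-colour : ∀ {x l} → (x ≡ u⁺ l) ⊎ (x ≡ u⁻ l) → col v x ≡ l
    label-colour {l = l} (inj₁ refl) = col-u⁺ l
    label-colour {l = l} (inj₂ refl) = col-u⁻ l
    i≡j : i ≡ j
    i≡j = trans (sym (label-colour b-label)) (trans same (label-colour y-label))

  no-crossing-at-v : ∀ {b y} → Edge G v b → Edge G v y → b ≢ y → col v b ≡ col v y → ¬ Crosses W (φ b) V (φ y)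
  no-crossing-at-v {b} {y} eb ey b≢y same cr = ≢0⇒sgn≢nil (cross-d≢0 (neighbour≢v eb)) (σ≡-ˢσ⇒σ≡nil (trans (sym seen-from-v) seen-from-W))
    where
    open ≡-Reasoning
    σ = sgn (cross d (δ b))
    seen-from-W : sgn (orient V (φ b) (φ y)) ≡ -ˢ σ
    seen-from-W = begin
      sgn (orient V (φ b) (φ y))      ≡⟨ sym (sgn-orient-W (neighbour≢v eb) (neighbour≢v ey)) ⟩
      sgn (orient W (φ b) (φ y))      ≡⟨ crosses⇒opposite {W} {φ b} {V} {φ y} cr ⟩
      -ˢ sgn (orient W (φ b) V)       ≡⟨ cong -ˢ_ (sgn-orient-W-V b) ⟩
      -ˢ σ                            ∎
    seen-from-v : sgn (orient V (φ b) (φ y)) ≡ σ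
    seen-from-v = begin
      sgn (orient V (φ b) (φ y))        ≡⟨ sym (-ˢ-involutive _) ⟩
      -ˢ -ˢ sgn (orient V (φ b) (φ y))  ≡⟨ cong -ˢ_ (sym (trans (cong sgn (orient-swap V (φ b) (φ y))) (sgn-neg _))) ⟩
      -ˢ sgn (orient V (φ y) (φ b))     ≡⟨ cong -ˢ_ (crosses⇒opposite {V} {φ y} {W} {φ b} (crosses-swap {W} {φ b} {V} {φ y} cr)) ⟩
      -ˢ -ˢ sgn (orient V (φ y) W)      ≡⟨ -ˢ-involutive _ ⟩
      sgn (orient V (φ y) W)            ≡⟨ cong sgn (sym (orient-rotate W V (φ y))) ⟩
      sgn (orient W V (φ y))            ≡⟨ trans (cong sgn (orient-swap W (φ y) V)) (sgn-neg _) ⟩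
      -ˢ sgn (orient W (φ y) V)         ≡⟨ cong -ˢ_ (sgn-orient-W-V y) ⟩
      -ˢ sgn (cross d (δ y))            ≡⟨ cong -ˢ_ (same-colour-neighbours-separated eb ey b≢y same) ⟩
      -ˢ -ˢ σ                           ≡⟨ -ˢ-involutive σ ⟩
      σ                                 ∎

  no-crossing-away-from-v : ∀ {b c e} → Edge G v b → Edge G c e → c ≢ v → e ≢ v → b ≢ c → b ≢ e →
    col v b ≡ col c e → ¬ Crosses W (φ b) (φ c) (φ e)
  no-crossing-away-from-v {b} {c} {e} eb ece c≢v e≢v b≢c b≢e same cr =
    non-crossing v b c e eb ece (λ (v≡c , _) → c≢v (sym v≡c)) (λ (v≡e , _) → e≢v (sym v≡e)) same
      (opposite⇒crosses V (φ b) (φ c) (φ e) (orient≢0 c e v (Edge⇒≢ G ece) e≢v c≢v) e-sides b-sides)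
    where
    open ≡-Reasoning
    b≢v = neighbour≢v eb
    b-sides : sgn (orient V (φ b) (φ e)) ≡ -ˢ sgn (orient V (φ b) (φ c))
    b-sides = begin
      sgn (orient V (φ b) (φ e))      ≡⟨ sym (sgn-orient-W b≢v e≢v) ⟩
      sgn (orient W (φ b) (φ e))      ≡⟨ crosses⇒opposite {W} {φ b} {φ c} {φ e} cr ⟩
      -ˢ sgn (orient W (φ b) (φ c))   ≡⟨ cong -ˢ_ (sgn-orient-W b≢v c≢v) ⟩
      -ˢ sgn (orient V (φ b) (φ c))   ∎
    e-sides : sgn (orient (φ c) (φ e) (φ b)) ≡ -ˢ sgn (orient (φ c) (φ e) V)
    e-sides = begin
      sgn (orient (φ c) (φ e) (φ b))  ≡⟨ crosses⇒opposite {φ c} {φ e} {W} {φ b} (crosses-swap {W} {φ b} {φ c} {φ e} cr) ⟩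
      -ˢ sgn (orient (φ c) (φ e) W)   ≡⟨ cong (-ˢ_ ∘ sgn) (sym (orient-rotate W (φ c) (φ e))) ⟩
      -ˢ sgn (orient W (φ c) (φ e))   ≡⟨ cong -ˢ_ (sgn-orient-W c≢v e≢v) ⟩
      -ˢ sgn (orient V (φ c) (φ e))   ≡⟨ cong (-ˢ_ ∘ sgn) (orient-rotate V (φ c) (φ e)) ⟩
      -ˢ sgn (orient (φ c) (φ e) V)   ∎

  new-edge-crossing-free : ∀ {b c e} → Edge G v b → Edge G c e → col v b ≡ col c e → b ≢ c → b ≢ e →
    ¬ Crosses W (φ b) (φ c) (φ e)
  new-edge-crossing-free {b} {c} {e} eb ece same b≢c b≢e with c Finₚ.≟ v | e Finₚ.≟ v
  ... | yes refl | _        = no-crossing-at-v eb ece b≢e same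
  ... | no c≢v   | yes refl = no-crossing-at-v eb (Edge-sym G ece) b≢c (trans same (colour-sym c v ece))
                                ∘ crosses-flipʳ {W} {φ b} {φ c} {V}
  ... | no c≢v   | no e≢v   = no-crossing-away-from-v eb ece c≢v e≢v b≢c b≢e same

  new-vs-edge : ∀ {b c e} → Edge G v b → Edge G′ c e → zero ≢ c → zero ≢ e → suc b ≢ c → suc b ≢ e →
    col v b ≡ col′ c e → ¬ Crosses W (φ b) (φ′ c) (φ′ e)
  new-vs-edge {c = zero}          _  _   w≢c _   _   _   _    = ⊥-elim (w≢c refl)
  new-vs-edge {c = suc _} {zero}  _  _   _   w≢e _   _   _    = ⊥-elim (w≢e refl)
  new-vs-edge {c = suc _} {suc _} eb ece _   _   b≢c b≢e same =
    new-edge-crossing-free eb ece same (b≢c ∘ cong suc) (b≢e ∘ cong suc)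

  disjoint-edges-crossing-free : ∀ a b c e → Edge G′ a b → Edge G′ c e → a ≢ c → a ≢ e → b ≢ c → b ≢ e →
    col′ a b ≡ col′ c e → ¬ Crosses (φ′ a) (φ′ b) (φ′ c) (φ′ e)
  disjoint-edges-crossing-free zero zero _ _ () _
  disjoint-edges-crossing-free zero (suc b) c e eab ece a≢c a≢e b≢c b≢e same =
    new-vs-edge eab ece a≢c a≢e b≢c b≢e same
  disjoint-edges-crossing-free (suc a) zero c e eab ece a≢c a≢e b≢c b≢e same =
    new-vs-edge eab ece b≢c b≢e a≢c a≢e same ∘ crosses-flipˡ {φ a} {W} {φ′ c} {φ′ e}
  disjoint-edges-crossing-free (suc a) (suc b) zero zero _ ()
  disjoint-edges-crossing-free (suc a) (suc b) zero (suc e) eab ece a≢c a≢e b≢c b≢e same =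
    new-vs-edge ece eab (a≢c ∘ sym) (b≢c ∘ sym) (a≢e ∘ sym) (b≢e ∘ sym) (sym same)
      ∘ crosses-swap {φ a} {φ b} {W} {φ e}
  disjoint-edges-crossing-free (suc a) (suc b) (suc c) zero eab ece a≢c a≢e b≢c b≢e same =
    new-vs-edge ece eab (a≢e ∘ sym) (b≢e ∘ sym) (a≢c ∘ sym) (b≢c ∘ sym) (sym same)
      ∘ crosses-flipˡ {φ c} {W} {φ a} {φ b} ∘ crosses-swap {φ a} {φ b} {φ c} {W}
  disjoint-edges-crossing-free (suc a) (suc b) (suc c) (suc e) eab ece a≢c a≢e _ _ same =
    non-crossing a b c e eab ece (λ (a≡c , _) → a≢c (cong suc a≡c)) (λ (a≡e , _) → a≢e (cong suc a≡e)) same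

  thickness′ : ThicknessColouring G′ φ′ col′
  thickness′ = symmetric′ , crossing-free′
    where
    symmetric′ : ∀ a b → Edge G′ a b → col′ a b ≡ col′ b a
    symmetric′ zero    zero    ()
    symmetric′ zero    (suc b) _ = refl
    symmetric′ (suc a) zero    _ = refl
    symmetric′ (suc a) (suc b) e = colour-sym a b e
    crossing-free′ : ∀ a b c e → Edge G′ a b → Edge G′ c e → ¬ ((a ≡ c) × (b ≡ e)) → ¬ ((a ≡ e) × (b ≡ c)) →
      col′ a b ≡ col′ c e → ¬ Crosses (φ′ a) (φ′ b) (φ′ c) (φ′ e)
    crossing-free′ a b c e eab ece not-same not-reversed same cr
      with crossing-edges-disjoint general-position′ (Edge⇒≢ G′ eab) (Edge⇒≢ G′ ece) not-same not-reversed cr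
    ... | a≢c , a≢e , b≢c , b≢e = disjoint-edges-crossing-free a b c e eab ece a≢c a≢e b≢c b≢e same cr

  ray-W≢0ᵥ : ∀ x b → ray W x b ≢ 0ᵥ
  ray-W≢0ᵥ x b = signed≢0ᵥ b (W≢φ x ∘ sym ∘ vec≡0ᵥ)

  sgn-cross-rays-W : ∀ {x y} b b′ → x ≢ v → y ≢ v →
    sgn (cross (ray W x b) (ray W y b′)) ≡ sgn (cross (ray V x b) (ray V y b′))
  sgn-cross-rays-W b b′ x≢v y≢v = trans (sgn-cross-signed b b′ _ _)
    (trans (cong (flipˢ b ∘ flipˢ b′) (sgn-orient-W x≢v y≢v)) (sym (sgn-cross-signed b b′ _ _)))

  cw-at-W⇒cw-at-V : ∀ {x₁ x₂ x₃} b₁ b₂ b₃ → x₁ ≢ v → x₂ ≢ v → x₃ ≢ v → x₁ ≢ x₃ →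
    CwBetween (ray W x₁ b₁) (ray W x₂ b₂) (ray W x₃ b₃) → CwBetween (ray V x₁ b₁) (ray V x₂ b₂) (ray V x₃ b₃)
  cw-at-W⇒cw-at-V {x₁} {x₂} {x₃} b₁ b₂ b₃ x₁≢v x₂≢v x₃≢v x₁≢x₃ =
    cwBetween-transport (ray-W≢0ᵥ x₁ b₁) (ray-W≢0ᵥ x₂ b₂) (ray-W≢0ᵥ x₃ b₃)
      (signed≢0ᵥ b₁ (δ≢0ᵥ x₁≢v)) (signed≢0ᵥ b₂ (δ≢0ᵥ x₂≢v)) (signed≢0ᵥ b₃ (δ≢0ᵥ x₃≢v))
      (cross-signed≢0 b₁ b₃ (orient-W≢0 x₁≢x₃))
      (sgn-cross-rays-W b₂ b₁ x₂≢v x₁≢v) (sgn-cross-rays-W b₃ b₂ x₃≢v x₂≢v) (sgn-cross-rays-W b₁ b₃ x₁≢v x₃≢v)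

  no-ray-between-at-w : ∀ {x y} b b′ → x ≢ v → y ≢ v → x ≢ y →
    (∀ s → InR G φ v s → ¬ CwBetween (ray V x b) s (ray V y b′)) →
    ∀ s → InR G′ φ′ zero s → ¬ CwBetween (ray W x b) s (ray W y b′)
  no-ray-between-at-w b b′ x≢v y≢v x≢y none _ (zero , () , _)
  no-ray-between-at-w b b′ x≢v y≢v x≢y none _ (suc u , e , inj₁ refl) =
    none (ray V u false) (ray-in-R e false) ∘ cw-at-W⇒cw-at-V b false b′ x≢v (neighbour≢v e) y≢v x≢y
  no-ray-between-at-w b b′ x≢v y≢v x≢y none _ (suc u , e , inj₂ refl) =
    none (ray V u true) (ray-in-R e true) ∘ cw-at-W⇒cw-at-V b true b′ x≢v (neighbour≢v e) y≢v x≢y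

  consecutive-at-w : ∀ {x y} b b′ → x ≢ v → y ≢ v → x ≢ y →
    ConsecutiveR G φ v (ray V x b) (ray V y b′) → ConsecutiveR G′ φ′ zero (ray W x b) (ray W y b′)
  consecutive-at-w b b′ x≢v y≢v x≢y (inj₁ none) = inj₁ (no-ray-between-at-w b b′ x≢v y≢v x≢y none)
  consecutive-at-w b b′ x≢v y≢v x≢y (inj₂ none) = inj₂ (no-ray-between-at-w b′ b y≢v x≢v (x≢y ∘ sym) none)

  fan-at-w : Fan G′ φ′ zero k col′
  fan-at-w = simplicial-w , suc ∘ L , (L′-injective , L-edge , L′-onto , L′-consecutive) , balanced-w ,
             proj₂ (proj₂ (proj₂ (proj₂ fan)))
    where
    simplicial-w : Simplicial (2 ℕ.* k) G′ zero
    simplicial-w = trans (degree-addOnto-new G v) (proj₁ (proj₁ fan)) , clique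
      where
      clique : ∀ a b → Edge G′ zero a → Edge G′ zero b → a ≢ b → Edge G′ a b
      clique zero    _       ()
      clique (suc a) zero    _  ()
      clique (suc a) (suc b) ea eb a≢b = proj₂ (proj₁ fan) a b ea eb (a≢b ∘ cong suc)
    L′-injective : ∀ p q → suc (L p) ≡ suc (L q) → p ≡ q
    L′-injective p q = L-injective p q ∘ suc-injective
    L′-onto : ∀ u → Edge G′ zero u → Σ (Fin (k ℕ.+ k)) λ p → suc (L p) ≡ u
    L′-onto zero    ()
    L′-onto (suc u) e = let (p , Lp≡u) = L-onto u e in p , cong suc Lp≡u
    L′-consecutive : ∀ p q → CyclicSuccessor (k ℕ.+ k) p q →
      ∀ u → Edge G′ zero u → ¬ CwBetween (ray W (L p) false) (dir G′ φ′ zero u) (ray W (L q) false)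
    L′-consecutive p q next zero ()
    L′-consecutive p q next (suc u) e = proj₂ (proj₂ (proj₂ L-clockwise)) p q next u e
      ∘ cw-at-W⇒cw-at-V false false false (neighbour≢v (L-edge p)) (neighbour≢v e) (neighbour≢v (L-edge q))
          (cyclic-successor≢ {k} next ∘ L-injective p q)
    balanced-w : Balanced G′ φ′ zero k (suc ∘ L)
    balanced-w j = consecutive-at-w false true (u⁺≢v j) (u⁻≢v j) (u⁺≢u⁻ j j) (proj₁ (L-balanced j)) ,
                   consecutive-at-w false true (u⁻≢v j) (u⁺≢v j) (u⁺≢u⁻ j j ∘ sym) (proj₂ (L-balanced j))

  simplicial′⇒non-neighbour : ∀ {y} → Simplicial (2 ℕ.* k) G′ (suc y) → ¬ Edge G v y
  simplicial′⇒non-neighbour {y} (_ , clique) e = Edge⇒≢ G (clique zero (suc v) e (Edge-sym G e) (λ ())) refl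

  simplicial′⇒simplicial : ∀ {y} → Simplicial (2 ℕ.* k) G′ (suc y) → Simplicial (2 ℕ.* k) G y
  simplicial′⇒simplicial {y} simp′@(degree′ , clique) =
    trans (sym (trans (degree-addOnto-old G v y) (cong (λ b → (if b then 1 else 0) ℕ.+ degree G y) not-adjacent)))
          degree′ ,
    λ a b ea eb a≢b → clique (suc a) (suc b) ea eb (a≢b ∘ suc-injective)
    where
    not-adjacent : adj G v y ≡ false
    not-adjacent = to T-not-≡ (¬T⇒Tnot (simplicial′⇒non-neighbour simp′))

  fan-persists : ∀ {y} → ¬ Edge G v y → Simplicial (2 ℕ.* k) G′ (suc y) → Fan G φ y k col → Fan G′ φ′ (suc y) k col′
  fan-persists {y} ¬vy simp′ (_ , M , (M-injective , M-edge , M-onto , M-consecutive) , M-balanced , M-colours) =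
    simp′ , suc ∘ M , (M-injective′ , M-edge , M-onto′ , M-consecutive′) , balanced′ , M-colours
    where
    M-injective′ : ∀ p q → suc (M p) ≡ suc (M q) → p ≡ q
    M-injective′ p q = M-injective p q ∘ suc-injective
    M-onto′ : ∀ u → Edge G′ (suc y) u → Σ (Fin (k ℕ.+ k)) λ p → suc (M p) ≡ u
    M-onto′ zero    e = ⊥-elim (¬vy e)
    M-onto′ (suc u) e = let (p , Mp≡u) = M-onto u e in p , cong suc Mp≡u
    M-consecutive′ : ∀ p q → CyclicSuccessor (k ℕ.+ k) p q →
      ∀ u → Edge G′ (suc y) u → ¬ CwBetween (dir G φ y (M p)) (dir G′ φ′ (suc y) u) (dir G φ y (M q))
    M-consecutive′ p q next zero    e = ⊥-elim (¬vy e)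
    M-consecutive′ p q next (suc u) e = M-consecutive p q next u e
    same-rays : ∀ {s} → InR G′ φ′ (suc y) s → InR G φ y s
    same-rays (zero  , e , _) = ⊥-elim (¬vy e)
    same-rays (suc u , e , s≡) = u , e , s≡
    consecutive′ : ∀ {r r′} → ConsecutiveR G φ y r r′ → ConsecutiveR G′ φ′ (suc y) r r′
    consecutive′ (inj₁ none) = inj₁ λ s → none s ∘ same-rays
    consecutive′ (inj₂ none) = inj₂ λ s → none s ∘ same-rays
    balanced′ : Balanced G′ φ′ (suc y) k (suc ∘ M)
    balanced′ j = consecutive′ (proj₁ (M-balanced j)) , consecutive′ (proj₂ (M-balanced j))

  fan-at-old-vertex : ∀ y → Simplicial (2 ℕ.* k) G′ (suc y) → Dec (y ≡ v) → Fan G′ φ′ (suc y) k col′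
  fan-at-old-vertex y simp′ (yes y≡v) = subst (λ z → Fan G′ φ′ (suc z) k col′) (sym y≡v)
    (fan-persists (simplicial′⇒non-neighbour simp-v) simp-v fan)
    where
    simp-v = subst (λ z → Simplicial (2 ℕ.* k) G′ (suc z)) y≡v simp′
  fan-at-old-vertex y simp′ (no y≢v) =
    fan-persists ¬vy simp′ (proj₂ (proj₂ (proj₂ good)) G-incomplete y (simplicial′⇒simplicial simp′))
    where
    ¬vy : ¬ Edge G v y
    ¬vy = simplicial′⇒non-neighbour simp′
    G-incomplete : ¬ IsoComplete G (ℕ.suc (2 ℕ.* k))
    G-incomplete (_ , complete) = ¬vy (complete v y (y≢v ∘ sym))

  fans′ : ¬ IsoComplete G′ (ℕ.suc (2 ℕ.* k)) → ∀ x → Simplicial (2 ℕ.* k) G′ x → Fan G′ φ′ x k col′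
  fans′ _ zero    _     = fan-at-w
  fans′ _ (suc y) simp′ = fan-at-old-vertex y simp′ (y Finₚ.≟ v)

  good′ : Good k G′ φ′ col′
  good′ = general-position′ , thickness′ , (λ _ → zero , fan-at-w) , fans′

lemma4 : (k : ℕ) → 2 ℕ.≤ k → {n : ℕ} (G : Graph n) → KTree (2 ℕ.* k) G →
         (φ : Drawing n) (col : Colouring n k) → Good k G φ col →
         (v : Fin n) → Fan G φ v k col →
         Σ (Drawing (ℕ.suc n)) (λ φ′ →
           ((i : Fin n) → φ′ (suc i) ≡ φ i) ×
           Σ (Colouring (ℕ.suc n) k) (λ col′ → Good k (addOnto G v) φ′ col′))
lemma4 (ℕ.suc k) (s≤s _) G _ φ col good v fan = φ′ , (λ _ → refl) , col′ , good′
  where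
  open Insertion G φ col good v fan zero
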